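{- Let $n\geq k\geq l\geq 1$ be integers, and let $A_i=(0,2i-2)$, $B_i=(i-1,2i-2)$. Then $d_{k,l}(q)=\sum_{\Omega}\psi(\Omega)$, where the sum runs over all families $\Omega=(\omega_i)_{i\in[n]\setminus\{k\}}$ of pairwise disjoint lattice paths such that $\omega_i$ goes from $A_i$ to $B_i$ for $1\leq i<l$ and for $k<i\leq n$, and $\omega_i$ goes from $A_{i+1}$ to $B_i$ for $l\leq i<k$.
   Context: For $m\in\mathbb Z$, $r\in\mathbb N$: $(x;q)_r=(1-x)(1-xq)\cdots(1-xq^{r-1})$ and ${m\brack r}_q=\frac{(q^{m-r+1};q)_r}{(q;q)_r}$. Let $H_q$ be the lower unitriangular matrix with entries $(H_q)_{i,j}={ -j\brack 2i-2j}_q\,q^{(i-j)(2i-1)}$ $(={2i-j-1\brack 2i-2j}_q)$ for $j\leq i$ and $0$ for $j>i$, and write $H_q^{ -1}=((-1)^{i-j}d_{i,j}(q))_{i,j\geq 1}$. A lattice path from $(a,b)$ to $(c,d)$ is a sequence of integer points from $(a,b)$ to $(c,d)$ each step of which is $(1,0)$ or $(0,-1)$. For such a path $w$, $|\lambda_w|=\sum(x-a)$ over all steps $(0,-1)$ of $w$, $x$ being the abscissa of the step. Paths are disjoint if they share no point. For a family $\Omega=(\omega_i)$, $\psi(\Omega)=q^{\sum_i|\lambda_{\omega_i}|}$. -}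

module Defs where

open import Level using (Level)
open import Data.Nat using (ℕ; zero; suc; _+_; _*_; _∸_; _≤_; _<_; _≤?_; _<?_; _≟_)
open import Data.Nat.Properties using () renaming (_≟_ to _≟ℕ_)
open import Data.Product using (_×_; _,_)
open import Data.Product.Properties using (≡-dec)
open import Data.List using (List; []; _∷_; map; concatMap; filter; upTo)
open import Data.List.Relation.Unary.All using (All; all?)
open import Data.List.Relation.Unary.AllPairs using (AllPairs; allPairs?)
open import Data.List.Membership.DecPropositional (≡-dec _≟ℕ_ _≟ℕ_) using (_∈_; _∈?_)
open import Relation.Nullary using (¬_; Dec; yes; no; does; ¬?)
open import Relation.Nullary.Decidable using (_×-dec_)
open import Algebra.Bundles using (CommutativeRing)

-- A step is (1,0) (east) or (0,-1) (south).
data Step : Set where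
  E S : Step

Point : Set
Point = ℕ × ℕ

words : ℕ → ℕ → List (List Step)
words zero    zero    = [] ∷ []
words (suc e) zero    = map (E ∷_) (words e zero)
words zero    (suc s) = map (S ∷_) (words zero s)
words (suc e) (suc s) = map (E ∷_) (words e (suc s)) ++′ map (S ∷_) (words (suc e) s)
  where
  _++′_ : List (List Step) → List (List Step) → List (List Step)
  [] ++′ ys = ys
  (x ∷ xs) ++′ ys = x ∷ (xs ++′ ys)

Path : Set
Path = Point × List Step

paths : Point → Point → List Path
paths (a , b) (c , d) with a ≤? c | d ≤? b
... | yes _ | yes _ = map ((a , b) ,_) (words (c ∸ a) (b ∸ d))
... | _     | _     = []

pointsFrom : Point → List Step → List Point
pointsFrom p []             = p ∷ []
pointsFrom (x , y) (E ∷ w) = (x , y) ∷ pointsFrom (suc x , y) w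
pointsFrom (x , y) (S ∷ w) = (x , y) ∷ pointsFrom (x , y ∸ 1) w

points : Path → List Point
points (p , w) = pointsFrom p w

-- |λ_w| = Σ (x - a) over the south steps of w, x the abscissa of the step;
-- the first argument is the current offset x - a.
areaFrom : ℕ → List Step → ℕ
areaFrom off []      = 0
areaFrom off (E ∷ w) = areaFrom (suc off) w
areaFrom off (S ∷ w) = off + areaFrom off w

area : Path → ℕ
area (_ , w) = areaFrom 0 w

DisjointPaths : Path → Path → Set
DisjointPaths ω ω' = All (λ p → ¬ (p ∈ points ω')) (points ω)

disjointPaths? : (ω ω' : Path) → Dec (DisjointPaths ω ω')
disjointPaths? ω ω' = all? (λ p → ¬? (p ∈? points ω')) (points ω)

PairwiseDisjoint : List Path → Set
PairwiseDisjoint = AllPairs DisjointPaths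

pairwiseDisjoint? : (Ω : List Path) → Dec (PairwiseDisjoint Ω)
pairwiseDisjoint? = allPairs? disjointPaths?

families : List (Point × Point) → List (List Path)
families []             = [] ∷ []
families ((s , t) ∷ es) =
  concatMap (λ ω → map (ω ∷_) (families es)) (paths s t)

totalArea : List Path → ℕ
totalArea []      = 0
totalArea (ω ∷ Ω) = area ω + totalArea Ω

A B : ℕ → Point
A i = (0 , 2 * i ∸ 2)
B i = (i ∸ 1 , 2 * i ∸ 2)

endpoint : ℕ → ℕ → ℕ → Point × Point
endpoint k l i with l ≤? i | i <? k
... | yes _ | yes _ = (A (suc i) , B i)
... | _     | _     = (A i , B i)

indicesWithout : ℕ → ℕ → List ℕ
indicesWithout n k = filter (λ i → ¬? (i ≟ k)) (map suc (upTo n))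

endpoints : ℕ → ℕ → ℕ → List (Point × Point)
endpoints n k l = map (endpoint k l) (indicesWithout n k)

admissibleFamilies : ℕ → ℕ → ℕ → List (List Path)
admissibleFamilies n k l = filter pairwiseDisjoint? (families (endpoints n k l))

-- Ring-valued part (q is an element of an arbitrary commutative ring;
-- taking R = ℤ[q] and q the indeterminate gives the polynomial identity)

module _ {c ℓ : Level} (R : CommutativeRing c ℓ) where
  open CommutativeRing R renaming (_+_ to _+ᴿ_; _*_ to _*ᴿ_)

  pow : Carrier → ℕ → Carrier
  pow x zero    = 1#
  pow x (suc m) = x *ᴿ pow x m

  sumTo : ℕ → (ℕ → Carrier) → Carrier
  sumTo zero    f = 0#
  sumTo (suc i) f = sumTo i f +ᴿ f (suc i)

  gauss : Carrier → ℕ → ℕ → Carrier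
  gauss q m       zero    = 1#
  gauss q zero    (suc r) = 0#
  gauss q (suc m) (suc r) = gauss q m r +ᴿ pow q (suc r) *ᴿ gauss q m (suc r)

  Hq : Carrier → ℕ → ℕ → Carrier
  Hq q i j with j ≤? i
  ... | yes _ = gauss q (2 * i ∸ j ∸ 1) (2 * i ∸ 2 * j)
  ... | no  _ = 0#

  δ : ℕ → ℕ → Carrier
  δ i j with i ≟ j
  ... | yes _ = 1#
  ... | no  _ = 0#

  -- M is the inverse of H_q:  H_q · M = I  (the sum Σ_m H_{i,m} M_{m,j} is
  -- over m ≤ i since H_q is lower triangular)
  IsInverseOfH : Carrier → (ℕ → ℕ → Carrier) → Set ℓ
  IsInverseOfH q M = ∀ i j → 1 ≤ i → 1 ≤ j →
    sumTo i (λ m → Hq q i m *ᴿ M m j) ≈ δ i j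

  ψ : Carrier → List Path → Carrier
  ψ q Ω = pow q (totalArea Ω)

  sumList : List (List Path) → (List Path → Carrier) → Carrier
  sumList []       f = 0#
  sumList (x ∷ xs) f = f x +ᴿ sumList xs f

{-# OPTIONS --safe #-}
module Submission where

-- Column l of H_q⁻¹ is the unique solution X of the lower unitriangular system H_q X = e_l, so it
-- suffices to exhibit one.  Counting partitions by their largest part c turns the entries of H_q into
-- sums, H_(m+j, m) = ∑_(c<m) largestPart (2j) c.  The paths ω_l, …, ω_(k-1) have two south steps each,
-- in columns aᵢ ≤ bᵢ, and neighbours are disjoint iff a_(i-1) < bᵢ, so their generating function d_t
-- (t = k - l) is a transfer-matrix product (`chain`).  Multiplying H_(l+u+j, l+u) by d_(u+1) and
-- comparing c with the first south column a of the top path splits the product into two terms: a < c,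
-- and c ≤ a, where the two south steps become two more parts of the partition.  Hence
-- ∑_t (-1)^t H_(l+T, l+t) d_t telescopes to a term that vanishes unless T = 0, and (-1)^t d_t is the
-- column.  Finally, the paths ωᵢ with i < l or i > k are horizontal, lie in rows separated from the
-- others and contribute a factor 1, so the family sum is d_(k-l).

open import Defs
open import Level using (Level)
open import Data.Nat as ℕ using (ℕ; zero; suc; z≤n; s≤s; _≤_; _<_; _∸_; _≤?_; _<?_)
import Data.Nat.Properties as ℕ
open import Data.Nat.Solver using (module +-*-Solver)
open import Function using (_∋_)
open import Data.List using (List; []; _∷_; _++_; map; concatMap; filter; replicate; applyUpTo; upTo)
open import Data.List.Relation.Unary.All as All using (All; []; _∷_)
import Data.List.Relation.Unary.All.Properties as All
open import Data.List.Properties using (++-assoc; map-++; map-cong-local; map-applyUpTo; filter-++; filter-all; filter-reject)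
open import Data.List.Relation.Unary.AllPairs using (AllPairs; []; _∷_)
import Data.List.Relation.Unary.AllPairs.Properties as AllPairs
open import Data.List.Relation.Unary.Any using (here; there)
open import Data.List.Membership.Propositional using (_∈_)
open import Data.Product using (_×_; _,_; proj₁; proj₂)
open import Data.Sum using (inj₁; inj₂)
open import Data.Empty using (⊥; ⊥-elim)
open import Relation.Nullary using (¬_; ¬?; Dec; yes; no)
open import Relation.Binary.PropositionalEquality as ≡ using (_≡_; _≢_)
open import Algebra.Bundles using (CommutativeRing)
import Algebra.Properties.CommutativeSemigroup as CommSemigroupProperties
import Algebra.Properties.Ring as RingProperties
import Algebra.Solver.Ring.NaturalCoefficients.Default as NaturalSolver
import Relation.Binary.Reasoning.Setoid as SetoidReasoning

module RingLemmas {c ℓ : Level} (R : CommutativeRing c ℓ) where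

  open CommutativeRing R hiding (zero)
  open SetoidReasoning setoid

  private
    module +-Props = CommSemigroupProperties +-commutativeSemigroup

  𝟙 : ∀ {p} {P : Set p} → Dec P → Carrier
  𝟙 (yes _) = 1#
  𝟙 (no _)  = 0#

  module _ {p} {P : Set p} where

    𝟙-yes : (d : Dec P) → P → 𝟙 d ≈ 1#
    𝟙-yes (yes _) _  = refl
    𝟙-yes (no ¬p) p′ = ⊥-elim (¬p p′)

    𝟙-no : (d : Dec P) → ¬ P → 𝟙 d ≈ 0#
    𝟙-no (yes p′) ¬p = ⊥-elim (¬p p′)
    𝟙-no (no _)   _  = refl

    𝟙-*-cong : (d : Dec P) {x y : Carrier} → (P → x ≈ y) → 𝟙 d * x ≈ 𝟙 d * y
    𝟙-*-cong (yes p′) x≈y = *-congˡ (x≈y p′)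
    𝟙-*-cong (no _)   _   = trans (zeroˡ _) (sym (zeroˡ _))

    𝟙-⇔ : ∀ {p′} {Q : Set p′} (d : Dec P) (e : Dec Q) → (P → Q) → (Q → P) → 𝟙 d ≈ 𝟙 e
    𝟙-⇔ d (yes q) _ Q⇒P = 𝟙-yes d (Q⇒P q)
    𝟙-⇔ d (no ¬q) P⇒Q _ = 𝟙-no d (λ p′ → ¬q (P⇒Q p′))

    𝟙-∧ : ∀ {p₁ p₂} {P₁ : Set p₁} {P₂ : Set p₂} (d : Dec P) (d₁ : Dec P₁) (d₂ : Dec P₂) →
          (P → P₁ × P₂) → (P₁ → P₂ → P) → 𝟙 d ≈ 𝟙 d₁ * 𝟙 d₂
    𝟙-∧ d (yes p₁) (yes p₂) _ intro = trans (𝟙-yes d (intro p₁ p₂)) (sym (*-identityˡ 1#))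
    𝟙-∧ d (yes _)  (no ¬p₂) elim _  = trans (𝟙-no d (λ p′ → ¬p₂ (proj₂ (elim p′)))) (sym (zeroʳ 1#))
    𝟙-∧ d (no ¬p₁) d₂       elim _  = trans (𝟙-no d (λ p′ → ¬p₁ (proj₁ (elim p′)))) (sym (zeroˡ (𝟙 d₂)))

  pow-+ : ∀ x m n → pow R x (m ℕ.+ n) ≈ pow R x m * pow R x n
  pow-+ x zero    n = sym (*-identityˡ _)
  pow-+ x (suc m) n = trans (*-congˡ (pow-+ x m n)) (sym (*-assoc _ _ _))

  ∑< : ℕ → (ℕ → Carrier) → Carrier
  ∑< zero    f = 0#
  ∑< (suc n) f = ∑< n f + f n

  syntax ∑< n (λ i → x) = ∑[ i < n ] x

  ∑<-cong : ∀ n {f g : ℕ → Carrier} → (∀ i → i < n → f i ≈ g i) → ∑< n f ≈ ∑< n g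
  ∑<-cong zero    f≈g = refl
  ∑<-cong (suc n) f≈g = +-cong (∑<-cong n (λ i i<n → f≈g i (ℕ.m<n⇒m<1+n i<n))) (f≈g n ℕ.≤-refl)

  ∑<-zero : ∀ n → ∑[ i < n ] 0# ≈ 0#
  ∑<-zero zero    = refl
  ∑<-zero (suc n) = trans (+-identityʳ _) (∑<-zero n)

  ∑<-distrib-+ : ∀ n (f g : ℕ → Carrier) → ∑[ i < n ] (f i + g i) ≈ ∑< n f + ∑< n g
  ∑<-distrib-+ zero    f g = sym (+-identityˡ 0#)
  ∑<-distrib-+ (suc n) f g =
    trans (+-congʳ (∑<-distrib-+ n f g)) (+-Props.interchange _ _ _ _)

  *-distribˡ-∑< : ∀ n x (f : ℕ → Carrier) → x * ∑< n f ≈ ∑[ i < n ] (x * f i)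
  *-distribˡ-∑< zero    x f = zeroʳ x
  *-distribˡ-∑< (suc n) x f = trans (distribˡ x _ _) (+-congʳ (*-distribˡ-∑< n x f))

  *-distribʳ-∑< : ∀ n x (f : ℕ → Carrier) → ∑< n f * x ≈ ∑[ i < n ] (f i * x)
  *-distribʳ-∑< zero    x f = zeroˡ x
  *-distribʳ-∑< (suc n) x f = trans (distribʳ x _ _) (+-congʳ (*-distribʳ-∑< n x f))

  ∑<-comm : ∀ m n (f : ℕ → ℕ → Carrier) → ∑[ i < m ] ∑[ j < n ] f i j ≈ ∑[ j < n ] ∑[ i < m ] f i j
  ∑<-comm zero    n f = sym (∑<-zero n)
  ∑<-comm (suc m) n f = trans (+-congʳ (∑<-comm m n f)) (sym (∑<-distrib-+ n _ _))

  ∑<-+ : ∀ m n (f : ℕ → Carrier) → ∑< (m ℕ.+ n) f ≈ ∑< m f + ∑[ i < n ] f (m ℕ.+ i)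
  ∑<-+ m zero    f rewrite ℕ.+-identityʳ m = sym (+-identityʳ _)
  ∑<-+ m (suc n) f rewrite ℕ.+-suc m n = trans (+-congʳ (∑<-+ m n f)) (+-assoc _ _ _)

  ∑<-suc : ∀ n (f : ℕ → Carrier) → ∑< (suc n) f ≈ f 0 + ∑[ i < n ] f (suc i)
  ∑<-suc n f = trans (∑<-+ 1 n f) (+-congʳ (+-identityˡ (f 0)))

  ∑<-restrict : ∀ m n (f : ℕ → Carrier) → m ≤ n → ∑< m f ≈ ∑[ i < n ] (𝟙 (i <? m) * f i)
  ∑<-restrict m n f m≤n = begin
    ∑< m f
      ≈⟨ ∑<-cong m (λ i i<m → sym (trans (*-congʳ (𝟙-yes (i <? m) i<m)) (*-identityˡ _))) ⟩
    ∑[ i < m ] (𝟙 (i <? m) * f i)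
      ≈⟨ sym (+-identityʳ _) ⟩
    ∑[ i < m ] (𝟙 (i <? m) * f i) + 0#
      ≈⟨ +-congˡ (sym (trans (∑<-cong (n ∸ m) (λ i _ → outside i)) (∑<-zero (n ∸ m)))) ⟩
    ∑[ i < m ] (𝟙 (i <? m) * f i) + ∑[ i < n ∸ m ] (𝟙 (m ℕ.+ i <? m) * f (m ℕ.+ i))
      ≈⟨ sym (∑<-+ m (n ∸ m) _) ⟩
    ∑< (m ℕ.+ (n ∸ m)) (λ i → 𝟙 (i <? m) * f i)
      ≡⟨ ≡.cong (λ k → ∑[ i < k ] (𝟙 (i <? m) * f i)) (ℕ.m+[n∸m]≡n m≤n) ⟩
    ∑[ i < n ] (𝟙 (i <? m) * f i) ∎
    where
    outside : ∀ i → 𝟙 (m ℕ.+ i <? m) * f (m ℕ.+ i) ≈ 0#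
    outside i = trans (*-congʳ (𝟙-no (m ℕ.+ i <? m) (ℕ.≤⇒≯ (ℕ.m≤m+n m i)))) (zeroˡ _)

  ∑∈ : ∀ {a} {A : Set a} → List A → (A → Carrier) → Carrier
  ∑∈ []       f = 0#
  ∑∈ (x ∷ xs) f = f x + ∑∈ xs f

  syntax ∑∈ xs (λ x → e) = ∑[ x ∈ xs ] e

  module _ {a} {A : Set a} where

    ∑∈-congᴬ : ∀ {p} {P : A → Set p} (xs : List A) {f g : A → Carrier} →
               All P xs → (∀ x → P x → f x ≈ g x) → ∑∈ xs f ≈ ∑∈ xs g
    ∑∈-congᴬ []       _          f≈g = refl
    ∑∈-congᴬ (x ∷ xs) (px ∷ pxs) f≈g = +-cong (f≈g x px) (∑∈-congᴬ xs pxs f≈g)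

    ∑∈-cong : ∀ (xs : List A) {f g : A → Carrier} → (∀ x → f x ≈ g x) → ∑∈ xs f ≈ ∑∈ xs g
    ∑∈-cong []       f≈g = refl
    ∑∈-cong (x ∷ xs) f≈g = +-cong (f≈g x) (∑∈-cong xs f≈g)

    ∑∈-zero : ∀ (xs : List A) → ∑[ x ∈ xs ] 0# ≈ 0#
    ∑∈-zero []       = refl
    ∑∈-zero (x ∷ xs) = trans (+-identityˡ _) (∑∈-zero xs)

    ∑∈-++ : ∀ xs ys (f : A → Carrier) → ∑∈ (xs ++ ys) f ≈ ∑∈ xs f + ∑∈ ys f
    ∑∈-++ []       ys f = sym (+-identityˡ _)
    ∑∈-++ (x ∷ xs) ys f = trans (+-congˡ (∑∈-++ xs ys f)) (sym (+-assoc _ _ _))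

    ∑∈-distrib-+ : ∀ xs (f g : A → Carrier) → ∑[ x ∈ xs ] (f x + g x) ≈ ∑∈ xs f + ∑∈ xs g
    ∑∈-distrib-+ []       f g = sym (+-identityˡ 0#)
    ∑∈-distrib-+ (x ∷ xs) f g =
      trans (+-congˡ (∑∈-distrib-+ xs f g)) (+-Props.interchange _ _ _ _)

    *-distribˡ-∑∈ : ∀ xs y (f : A → Carrier) → y * ∑∈ xs f ≈ ∑[ x ∈ xs ] (y * f x)
    *-distribˡ-∑∈ []       y f = zeroʳ y
    *-distribˡ-∑∈ (x ∷ xs) y f = trans (distribˡ y _ _) (+-congˡ (*-distribˡ-∑∈ xs y f))

    *-distribʳ-∑∈ : ∀ xs y (f : A → Carrier) → ∑∈ xs f * y ≈ ∑[ x ∈ xs ] (f x * y)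
    *-distribʳ-∑∈ []       y f = zeroˡ y
    *-distribʳ-∑∈ (x ∷ xs) y f = trans (distribʳ y _ _) (+-congˡ (*-distribʳ-∑∈ xs y f))

    ∑∈-filter : ∀ {p} {P : A → Set p} (P? : ∀ x → Dec (P x)) xs (f : A → Carrier) →
                ∑∈ (filter P? xs) f ≈ ∑[ x ∈ xs ] (𝟙 (P? x) * f x)
    ∑∈-filter P? []       f = refl
    ∑∈-filter P? (x ∷ xs) f with P? x
    ... | yes _ = +-cong (sym (*-identityˡ _)) (∑∈-filter P? xs f)
    ... | no  _ = trans (∑∈-filter P? xs f) (trans (sym (+-identityˡ _)) (+-congʳ (sym (zeroˡ _))))

  module _ {a b} {A : Set a} {B : Set b} where

    ∑∈-map : ∀ (g : B → A) xs (f : A → Carrier) → ∑∈ (map g xs) f ≈ ∑[ x ∈ xs ] f (g x)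
    ∑∈-map g []       f = refl
    ∑∈-map g (x ∷ xs) f = +-congˡ (∑∈-map g xs f)

    ∑∈-concatMap : ∀ (g : B → List A) xs (f : A → Carrier) →
                   ∑∈ (concatMap g xs) f ≈ ∑[ x ∈ xs ] ∑∈ (g x) f
    ∑∈-concatMap g []       f = refl
    ∑∈-concatMap g (x ∷ xs) f = trans (∑∈-++ (g x) _ f) (+-congˡ (∑∈-concatMap g xs f))

    ∑∈-comm : ∀ xs (ys : List B) (f : A → B → Carrier) →
              ∑[ x ∈ xs ] ∑[ y ∈ ys ] f x y ≈ ∑[ y ∈ ys ] ∑[ x ∈ xs ] f x y
    ∑∈-comm []       ys f = sym (∑∈-zero ys)
    ∑∈-comm (x ∷ xs) ys f = trans (+-congˡ (∑∈-comm xs ys f)) (sym (∑∈-distrib-+ ys _ _))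

  sumList≈∑∈ : ∀ xs f → sumList R xs f ≈ ∑∈ xs f
  sumList≈∑∈ []       f = refl
  sumList≈∑∈ (x ∷ xs) f = +-congˡ (sumList≈∑∈ xs f)

  sumTo≈∑< : ∀ n (f : ℕ → Carrier) → sumTo R n f ≈ ∑[ i < n ] f (suc i)
  sumTo≈∑< zero    f = refl
  sumTo≈∑< (suc n) f = +-congʳ (sumTo≈∑< n f)

module GaussianBinomials {c ℓ : Level} (R : CommutativeRing c ℓ) (q : CommutativeRing.Carrier R) where

  open CommutativeRing R hiding (zero)
  open RingLemmas R
  open SetoidReasoning setoid

  private
    module Ring-Solver = NaturalSolver commutativeSemiring

  q^_ : ℕ → Carrier
  q^_ = pow R q

  infix 8 q^_

  qbinom : ℕ → ℕ → Carrier
  qbinom = gauss R q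

  qbinom-above : ∀ m r → m < r → qbinom m r ≈ 0#
  qbinom-above zero    (suc r) _         = refl
  qbinom-above (suc m) (suc r) (s≤s m<r) =
    trans (+-cong (qbinom-above m r m<r) (trans (*-congˡ (qbinom-above m (suc r) (ℕ.m<n⇒m<1+n m<r))) (zeroʳ _)))
          (+-identityʳ 0#)

  qbinom-diag : ∀ m → qbinom m m ≈ 1#
  qbinom-diag zero    = refl
  qbinom-diag (suc m) =
    trans (+-cong (qbinom-diag m) (trans (*-congˡ (qbinom-above m (suc m) ℕ.≤-refl)) (zeroʳ _)))
          (+-identityʳ 1#)

  qbinom-pascal′ : ∀ r t → qbinom (suc (r ℕ.+ t)) (suc r) ≈ q^ t * qbinom (r ℕ.+ t) r + qbinom (r ℕ.+ t) (suc r)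
  qbinom-pascal′ zero zero = begin
    1# + (q * 1#) * 0# ≈⟨ +-congˡ (zeroʳ _) ⟩
    1# + 0#            ≈⟨ +-congʳ (sym (*-identityˡ 1#)) ⟩
    1# * 1# + 0#       ∎
  qbinom-pascal′ zero (suc t) = begin
    1# + (q * 1#) * qbinom (suc t) 1
      ≈⟨ +-congˡ (*-congˡ (qbinom-pascal′ zero t)) ⟩
    1# + (q * 1#) * (q^ t * 1# + qbinom t 1)
      ≈⟨ solve 3 (λ Q T G → con 1 :+ (Q :* con 1) :* (T :* con 1 :+ G)
                             := (Q :* T) :* con 1 :+ (con 1 :+ (Q :* con 1) :* G)) refl q (q^ t) (qbinom t 1) ⟩
    q^ suc t * 1# + (1# + (q * 1#) * qbinom t 1) ∎
    where open Ring-Solver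
  qbinom-pascal′ (suc r) zero rewrite ℕ.+-identityʳ r = begin
    qbinom (suc r) (suc r) + q^ suc (suc r) * qbinom (suc r) (suc (suc r))
      ≈⟨ +-cong (qbinom-diag (suc r)) (trans (*-congˡ above) (zeroʳ _)) ⟩
    1# + 0#
      ≈⟨ +-cong (trans (sym (*-identityˡ 1#)) (*-congˡ (sym (qbinom-diag (suc r))))) (sym above) ⟩
    1# * qbinom (suc r) (suc r) + qbinom (suc r) (suc (suc r)) ∎
    where
    above : qbinom (suc r) (suc (suc r)) ≈ 0#
    above = qbinom-above (suc r) (suc (suc r)) ℕ.≤-refl
  qbinom-pascal′ (suc r) (suc t) = begin
    qbinom (suc m) (suc r) + q^ suc (suc r) * qbinom (suc m) (suc (suc r))
      ≈⟨ +-cong (qbinom-pascal′ r (suc t)) (*-congˡ next) ⟩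
    (q^ suc t * x + y) + (q * q^ suc r) * (q^ t * y + z)
      ≈⟨ solve 6 (λ x y z Q P T → ((Q :* T) :* x :+ y) :+ (Q :* P) :* (T :* y :+ z)
                                   := (Q :* T) :* (x :+ P :* y) :+ (y :+ (Q :* P) :* z))
                 refl x y z q (q^ suc r) (q^ t) ⟩
    q^ suc t * (x + q^ suc r * y) + (y + q^ suc (suc r) * z) ∎
    where
    open Ring-Solver
    m : ℕ
    m = r ℕ.+ suc t
    x y z : Carrier
    x = qbinom m r
    y = qbinom m (suc r)
    z = qbinom m (suc (suc r))
    next : qbinom (suc m) (suc (suc r)) ≈ q^ t * y + z
    next = ≡.subst (λ k → qbinom (suc k) (suc (suc r)) ≈ q^ t * qbinom k (suc r) + qbinom k (suc (suc r)))
                   (≡.sym (ℕ.+-suc r t)) (qbinom-pascal′ (suc r) t)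

  -- largestPart s x = ∑ q^|λ| over the partitions λ into s parts (zero parts allowed) whose largest part is x.
  largestPart : ℕ → ℕ → Carrier
  largestPart zero    x = 𝟙 (x ℕ.≟ 0)
  largestPart (suc s) x = q^ x * ∑< (suc x) (largestPart s)

  ∑-q^-qbinom : ∀ s e → ∑[ x < suc e ] (q^ x * qbinom (s ℕ.+ x) s) ≈ qbinom (suc (s ℕ.+ e)) (suc s)
  ∑-q^-qbinom s zero rewrite ℕ.+-identityʳ s =
    trans (+-identityˡ _) (trans (*-identityˡ _) (trans (qbinom-diag s) (sym (qbinom-diag (suc s)))))
  ∑-q^-qbinom s (suc e) = begin
    ∑[ x < suc e ] (q^ x * qbinom (s ℕ.+ x) s) + q^ suc e * qbinom (s ℕ.+ suc e) s
      ≈⟨ +-congʳ (∑-q^-qbinom s e) ⟩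
    qbinom (suc (s ℕ.+ e)) (suc s) + q^ suc e * qbinom (s ℕ.+ suc e) s
      ≡⟨ ≡.cong (λ k → qbinom k (suc s) + q^ suc e * qbinom (s ℕ.+ suc e) s) (≡.sym (ℕ.+-suc s e)) ⟩
    qbinom (s ℕ.+ suc e) (suc s) + q^ suc e * qbinom (s ℕ.+ suc e) s
      ≈⟨ +-comm _ _ ⟩
    q^ suc e * qbinom (s ℕ.+ suc e) s + qbinom (s ℕ.+ suc e) (suc s)
      ≈⟨ sym (qbinom-pascal′ s (suc e)) ⟩
    qbinom (suc (s ℕ.+ suc e)) (suc s) ∎

  ∑-largestPart : ∀ s e → ∑< (suc e) (largestPart s) ≈ qbinom (s ℕ.+ e) s
  ∑-largestPart zero e = begin
    ∑< (suc e) (largestPart 0)                  ≈⟨ ∑<-suc e (largestPart 0) ⟩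
    1# + ∑[ x < e ] largestPart 0 (suc x)       ≈⟨ +-congˡ (∑<-zero e) ⟩
    1# + 0#                                     ≈⟨ +-identityʳ 1# ⟩
    1#                                          ∎
  ∑-largestPart (suc s) e =
    trans (∑<-cong (suc e) (λ x _ → *-congˡ (∑-largestPart s x))) (∑-q^-qbinom s e)

  Hq-diag : ∀ m → Hq R q (suc m) (suc m) ≈ 1#
  Hq-diag m with suc m ≤? suc m
  ... | yes _ rewrite ℕ.n∸n≡0 (2 ℕ.* suc m) = refl
  ... | no ¬≤ = ⊥-elim (¬≤ ℕ.≤-refl)

  Hq-as-∑-largestPart : ∀ m j → Hq R q (suc m ℕ.+ j) (suc m) ≈ ∑< (suc m) (largestPart (2 ℕ.* j))
  Hq-as-∑-largestPart m j with suc m ≤? suc m ℕ.+ j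
  ... | no ¬≤ = ⊥-elim (¬≤ (ℕ.m≤m+n (suc m) j))
  ... | yes _ = begin
    qbinom (2 ℕ.* (suc m ℕ.+ j) ∸ suc m ∸ 1) (2 ℕ.* (suc m ℕ.+ j) ∸ 2 ℕ.* suc m)
      ≡⟨ ≡.cong₂ qbinom size rank ⟩
    qbinom (2 ℕ.* j ℕ.+ m) (2 ℕ.* j)
      ≈⟨ sym (∑-largestPart (2 ℕ.* j) m) ⟩
    ∑< (suc m) (largestPart (2 ℕ.* j)) ∎
    where
    doubled : 2 ℕ.* (suc m ℕ.+ j) ≡ suc m ℕ.+ suc (2 ℕ.* j ℕ.+ m)
    doubled = solve 2 (λ m j → con 2 :* (con 1 :+ m :+ j) := (con 1 :+ m) :+ (con 1 :+ (con 2 :* j :+ m))) ≡.refl m j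
      where open +-*-Solver
    size : 2 ℕ.* (suc m ℕ.+ j) ∸ suc m ∸ 1 ≡ 2 ℕ.* j ℕ.+ m
    size = ≡.trans (≡.cong (λ k → k ∸ suc m ∸ 1) doubled) (≡.cong (_∸ 1) (ℕ.m+n∸m≡n (suc m) _))
    rank : 2 ℕ.* (suc m ℕ.+ j) ∸ 2 ℕ.* suc m ≡ 2 ℕ.* j
    rank = ≡.trans (≡.cong (_∸ 2 ℕ.* suc m) (ℕ.*-distribˡ-+ 2 (suc m) j)) (ℕ.m+n∸m≡n (2 ℕ.* suc m) (2 ℕ.* j))

  ∑-largestPart-suc : ∀ s N M (Y : ℕ → Carrier) → M ≤ N →
                      ∑[ c < N ] (largestPart s c * ∑[ a < M ] (𝟙 (c ≤? a) * (q^ a * Y a)))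
                        ≈ ∑[ a < M ] (largestPart (suc s) a * Y a)
  ∑-largestPart-suc s N M Y M≤N = begin
    ∑[ c < N ] (largestPart s c * ∑[ a < M ] (𝟙 (c ≤? a) * (q^ a * Y a)))
      ≈⟨ ∑<-cong N (λ c _ → *-distribˡ-∑< M _ _) ⟩
    ∑[ c < N ] ∑[ a < M ] (largestPart s c * (𝟙 (c ≤? a) * (q^ a * Y a)))
      ≈⟨ ∑<-comm N M _ ⟩
    ∑[ a < M ] ∑[ c < N ] (largestPart s c * (𝟙 (c ≤? a) * (q^ a * Y a)))
      ≈⟨ ∑<-cong M (λ a _ → ∑<-cong N (λ c _ → rearrange (largestPart s c) (𝟙 (c ≤? a)) (q^ a) (Y a))) ⟩
    ∑[ a < M ] ∑[ c < N ] (q^ a * (𝟙 (c ≤? a) * largestPart s c) * Y a)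
      ≈⟨ ∑<-cong M (λ a _ → sym (*-distribʳ-∑< N (Y a) _)) ⟩
    ∑[ a < M ] (∑[ c < N ] (q^ a * (𝟙 (c ≤? a) * largestPart s c)) * Y a)
      ≈⟨ ∑<-cong M (λ a a<M → *-congʳ (trans (sym (*-distribˡ-∑< N (q^ a) _)) (*-congˡ (sym (restrict a a<M))))) ⟩
    ∑[ a < M ] (largestPart (suc s) a * Y a) ∎
    where
    open Ring-Solver
    rearrange : ∀ g i x y → g * (i * (x * y)) ≈ x * (i * g) * y
    rearrange = solve 4 (λ g i x y → g :* (i :* (x :* y)) := x :* (i :* g) :* y) refl
    restrict : ∀ a → a < M → ∑< (suc a) (largestPart s) ≈ ∑[ c < N ] (𝟙 (c ≤? a) * largestPart s c)
    restrict a a<M = trans (∑<-restrict (suc a) N (largestPart s) (ℕ.≤-trans a<M M≤N))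
                           (∑<-cong N (λ c _ → *-congʳ (𝟙-⇔ (c <? suc a) (c ≤? a) ℕ.≤-pred s≤s)))

module LowerUnitriangular {c ℓ : Level} (R : CommutativeRing c ℓ) where

  open CommutativeRing R hiding (zero)
  open RingLemmas R
  open RingProperties ring using (+-cancelˡ)
  open SetoidReasoning setoid

  solution-unique : (H : ℕ → ℕ → Carrier) → (∀ m → H (suc m) (suc m) ≈ 1#) → (X Y : ℕ → Carrier) →
                    (∀ i → 1 ≤ i → sumTo R i (λ m → H i m * X m) ≈ sumTo R i (λ m → H i m * Y m)) →
                    ∀ i → 1 ≤ i → X i ≈ Y i
  solution-unique H diag X Y HX≈HY i 1≤i = agree-upTo i i 1≤i ℕ.≤-refl
    where
    agree-upTo : ∀ n m → 1 ≤ m → m ≤ n → X m ≈ Y m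
    agree-upTo zero    m 1≤m m≤0 = ⊥-elim (ℕ.<⇒≱ 1≤m m≤0)
    agree-upTo (suc n) m 1≤m m≤n+1 with ℕ.m≤n⇒m<n∨m≡n m≤n+1
    ... | inj₁ m<n+1  = agree-upTo n m 1≤m (ℕ.≤-pred m<n+1)
    ... | inj₂ ≡.refl = begin
      X (suc n)                       ≈⟨ sym (*-identityˡ _) ⟩
      1# * X (suc n)                  ≈⟨ *-congʳ (sym (diag n)) ⟩
      H (suc n) (suc n) * X (suc n)   ≈⟨ +-cancelˡ (sumTo R n (λ m → H (suc n) m * Y m)) _ _ last-terms ⟩
      H (suc n) (suc n) * Y (suc n)   ≈⟨ *-congʳ (diag n) ⟩
      1# * Y (suc n)                  ≈⟨ *-identityˡ _ ⟩
      Y (suc n)                       ∎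
      where
      earlier-terms : sumTo R n (λ m → H (suc n) m * Y m) ≈ sumTo R n (λ m → H (suc n) m * X m)
      earlier-terms = begin
        sumTo R n (λ m → H (suc n) m * Y m)        ≈⟨ sumTo≈∑< n _ ⟩
        ∑[ m < n ] (H (suc n) (suc m) * Y (suc m)) ≈⟨ ∑<-cong n (λ m m<n → *-congˡ (sym (agree-upTo n (suc m) (s≤s z≤n) m<n))) ⟩
        ∑[ m < n ] (H (suc n) (suc m) * X (suc m)) ≈⟨ sym (sumTo≈∑< n _) ⟩
        sumTo R n (λ m → H (suc n) m * X m)        ∎
      last-terms : sumTo R n (λ m → H (suc n) m * Y m) + H (suc n) (suc n) * X (suc n)
                 ≈ sumTo R n (λ m → H (suc n) m * Y m) + H (suc n) (suc n) * Y (suc n)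
      last-terms = trans (+-congʳ earlier-terms) (HX≈HY (suc n) (s≤s z≤n))

module MiddleChains {c ℓ : Level} (R : CommutativeRing c ℓ) (q : CommutativeRing.Carrier R) (l : ℕ) where

  open CommutativeRing R hiding (zero)
  open RingLemmas R
  open GaussianBinomials R q
  open SetoidReasoning setoid

  -- chain t c = ∑ q^(∑ aᵢ + bᵢ) over the columns aᵢ ≤ bᵢ < i of the two south steps of the paths
  -- ωᵢ : A (i + 1) → B i, l ≤ i < l + t, with a_(i-1) < bᵢ (disjointness of neighbours) and a_(l+t-1) < c.
  mutual
    chain : ℕ → ℕ → Carrier
    chain zero    c = 1#
    chain (suc t) c = ∑[ a < l ℕ.+ t ] (𝟙 (a <? c) * (q^ a * link t a))

    link : ℕ → ℕ → Carrier
    link t a = ∑[ b < l ℕ.+ t ] (𝟙 (a ≤? b) * (q^ b * chain t b))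

  middleSum : ℕ → Carrier
  middleSum zero    = 1#
  middleSum (suc t) = chain (suc t) (l ℕ.+ t)

  transfer : ℕ → ℕ → Carrier
  transfer s t = ∑[ c < l ℕ.+ t ] (largestPart s c * chain t c)

  middleSum-split : ∀ t c → middleSum (suc t) ≈ chain (suc t) c + ∑[ a < l ℕ.+ t ] (𝟙 (c ≤? a) * (q^ a * link t a))
  middleSum-split t c = begin
    ∑[ a < l ℕ.+ t ] (𝟙 (a <? l ℕ.+ t) * (q^ a * link t a))
      ≈⟨ ∑<-cong (l ℕ.+ t) (λ a a< → trans (*-congʳ (𝟙-yes (a <? l ℕ.+ t) a<)) (*-identityˡ _)) ⟩
    ∑[ a < l ℕ.+ t ] (q^ a * link t a)
      ≈⟨ ∑<-cong (l ℕ.+ t) (λ a _ → trans (sym (*-identityˡ _)) (trans (*-congʳ (sym (dichotomy a))) (distribʳ _ _ _))) ⟩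
    ∑[ a < l ℕ.+ t ] (𝟙 (a <? c) * (q^ a * link t a) + 𝟙 (c ≤? a) * (q^ a * link t a))
      ≈⟨ ∑<-distrib-+ (l ℕ.+ t) _ _ ⟩
    chain (suc t) c + ∑[ a < l ℕ.+ t ] (𝟙 (c ≤? a) * (q^ a * link t a)) ∎
    where
    dichotomy : ∀ a → 𝟙 (a <? c) + 𝟙 (c ≤? a) ≈ 1#
    dichotomy a with a <? c | c ≤? a
    ... | yes a<c | yes c≤a = ⊥-elim (ℕ.<⇒≱ a<c c≤a)
    ... | yes _   | no  _   = +-identityʳ 1#
    ... | no  _   | yes _   = +-identityˡ 1#
    ... | no  a≮c | no  c≰a = ⊥-elim (a≮c (ℕ.≰⇒> c≰a))

  ∑-largestPart-middleSum : ∀ s t → ∑< (l ℕ.+ suc t) (largestPart s) * middleSum (suc t)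
                                    ≈ transfer s (suc t) + transfer (2 ℕ.+ s) t
  ∑-largestPart-middleSum s t = begin
    ∑< (l ℕ.+ suc t) (largestPart s) * middleSum (suc t)
      ≈⟨ *-distribʳ-∑< (l ℕ.+ suc t) _ _ ⟩
    ∑[ c < l ℕ.+ suc t ] (largestPart s c * middleSum (suc t))
      ≈⟨ ∑<-cong (l ℕ.+ suc t) (λ c _ → trans (*-congˡ (middleSum-split t c)) (distribˡ _ _ _)) ⟩
    ∑[ c < l ℕ.+ suc t ] (largestPart s c * chain (suc t) c + largestPart s c * ∑[ a < l ℕ.+ t ] (𝟙 (c ≤? a) * (q^ a * link t a)))
      ≈⟨ ∑<-distrib-+ (l ℕ.+ suc t) _ _ ⟩
    transfer s (suc t) + ∑[ c < l ℕ.+ suc t ] (largestPart s c * ∑[ a < l ℕ.+ t ] (𝟙 (c ≤? a) * (q^ a * link t a)))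
      ≈⟨ +-congˡ (∑-largestPart-suc s (l ℕ.+ suc t) (l ℕ.+ t) (link t) (ℕ.+-monoʳ-≤ l (ℕ.n≤1+n t))) ⟩
    transfer s (suc t) + ∑[ a < l ℕ.+ t ] (largestPart (suc s) a * link t a)
      ≈⟨ +-congˡ (∑-largestPart-suc (suc s) (l ℕ.+ t) (l ℕ.+ t) (chain t) ℕ.≤-refl) ⟩
    transfer s (suc t) + transfer (2 ℕ.+ s) t ∎

  transfer-0-suc : ∀ t → transfer 0 (suc t) ≈ 0#
  transfer-0-suc t = trans (∑<-cong (l ℕ.+ suc t) (λ c _ → vanishes c)) (∑<-zero (l ℕ.+ suc t))
    where
    vanishes : ∀ c → largestPart 0 c * chain (suc t) c ≈ 0#
    vanishes zero    = trans (*-congˡ (trans (∑<-cong (l ℕ.+ t) (λ a _ → trans (*-congʳ (𝟙-no (a <? 0) λ ())) (zeroˡ _)))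
                                             (∑<-zero (l ℕ.+ t))))
                             (zeroʳ _)
    vanishes (suc c) = trans (*-congʳ (𝟙-no (suc c ℕ.≟ 0) λ ())) (zeroˡ _)

  transfer-s-0 : ∀ s → transfer s 0 ≈ ∑< l (largestPart s)
  transfer-s-0 s rewrite ℕ.+-identityʳ l = ∑<-cong l (λ c _ → *-identityʳ _)

module InverseColumn {c ℓ : Level} (R : CommutativeRing c ℓ) (q : CommutativeRing.Carrier R) (l′ : ℕ) where

  open CommutativeRing R hiding (zero)
  open RingLemmas R
  open GaussianBinomials R q
  open LowerUnitriangular R
  open SetoidReasoning setoid

  l : ℕ
  l = suc l′

  open MiddleChains R q l

  sgn : ℕ → Carrier
  sgn = pow R (- 1#)

  sgn-step : ∀ u x y → sgn u * x + sgn (suc u) * (y + x) ≈ sgn (suc u) * y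
  sgn-step u x y = begin
    sgn u * x + - 1# * sgn u * (y + x)                     ≈⟨ +-congˡ (distribˡ _ y x) ⟩
    sgn u * x + (- 1# * sgn u * y + - 1# * sgn u * x)      ≈⟨ +-Props.x∙yz≈y∙xz _ _ _ ⟩
    - 1# * sgn u * y + (sgn u * x + - 1# * sgn u * x)      ≈⟨ +-congˡ (sym (distribʳ x _ _)) ⟩
    - 1# * sgn u * y + (sgn u + - 1# * sgn u) * x          ≈⟨ +-congˡ (*-congʳ (+-congˡ (-1*x≈-x (sgn u)))) ⟩
    - 1# * sgn u * y + (sgn u - sgn u) * x                 ≈⟨ +-congˡ (trans (*-congʳ (-‿inverseʳ (sgn u))) (zeroˡ x)) ⟩
    - 1# * sgn u * y + 0#                                  ≈⟨ +-identityʳ _ ⟩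
    - 1# * sgn u * y                                       ∎
    where
    module +-Props = CommSemigroupProperties +-commutativeSemigroup
    open RingProperties ring using (-1*x≈-x)

  telescope : ∀ u j → ∑[ t < suc u ] (sgn t * (Hq R q (l ℕ.+ (u ℕ.+ j)) (l ℕ.+ t) * middleSum t))
                      ≈ sgn u * transfer (2 ℕ.* j) u
  telescope zero j = begin
    0# + 1# * (Hq R q (l ℕ.+ j) (l ℕ.+ 0) * 1#) ≈⟨ trans (+-identityˡ _) (trans (*-identityˡ _) (*-identityʳ _)) ⟩
    Hq R q (l ℕ.+ j) (l ℕ.+ 0)                 ≡⟨ ≡.cong (Hq R q (l ℕ.+ j)) (ℕ.+-identityʳ l) ⟩
    Hq R q (l ℕ.+ j) l                         ≈⟨ Hq-as-∑-largestPart l′ j ⟩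
    ∑< l (largestPart (2 ℕ.* j))               ≈⟨ sym (transfer-s-0 (2 ℕ.* j)) ⟩
    transfer (2 ℕ.* j) 0                       ≈⟨ sym (*-identityˡ _) ⟩
    1# * transfer (2 ℕ.* j) 0                  ∎
  telescope (suc u) j = begin
    ∑[ t < suc u ] (sgn t * (H (l ℕ.+ t) * middleSum t)) + sgn (suc u) * (H (l ℕ.+ suc u) * middleSum (suc u))
      ≈⟨ +-cong earlier (*-congˡ last) ⟩
    sgn u * transfer (2 ℕ.+ 2 ℕ.* j) u + sgn (suc u) * (transfer (2 ℕ.* j) (suc u) + transfer (2 ℕ.+ 2 ℕ.* j) u)
      ≈⟨ sgn-step u _ _ ⟩
    sgn (suc u) * transfer (2 ℕ.* j) (suc u) ∎
    where
    H : ℕ → Carrier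
    H = Hq R q (l ℕ.+ (suc u ℕ.+ j))
    earlier : ∑[ t < suc u ] (sgn t * (H (l ℕ.+ t) * middleSum t)) ≈ sgn u * transfer (2 ℕ.+ 2 ℕ.* j) u
    earlier = begin
      ∑[ t < suc u ] (sgn t * (H (l ℕ.+ t) * middleSum t))
        ≡⟨ ≡.cong (λ n → ∑[ t < suc u ] (sgn t * (Hq R q (l ℕ.+ n) (l ℕ.+ t) * middleSum t))) (≡.sym (ℕ.+-suc u j)) ⟩
      ∑[ t < suc u ] (sgn t * (Hq R q (l ℕ.+ (u ℕ.+ suc j)) (l ℕ.+ t) * middleSum t))
        ≈⟨ telescope u (suc j) ⟩
      sgn u * transfer (2 ℕ.* suc j) u
        ≡⟨ ≡.cong (λ s → sgn u * transfer s u) (ℕ.*-suc 2 j) ⟩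
      sgn u * transfer (2 ℕ.+ 2 ℕ.* j) u ∎
    last : H (l ℕ.+ suc u) * middleSum (suc u) ≈ transfer (2 ℕ.* j) (suc u) + transfer (2 ℕ.+ 2 ℕ.* j) u
    last = begin
      H (l ℕ.+ suc u) * middleSum (suc u)
        ≡⟨ ≡.cong (λ n → Hq R q n (l ℕ.+ suc u) * middleSum (suc u)) (≡.sym (ℕ.+-assoc l (suc u) j)) ⟩
      Hq R q (l ℕ.+ suc u ℕ.+ j) (l ℕ.+ suc u) * middleSum (suc u)
        ≈⟨ *-congʳ (Hq-as-∑-largestPart (l′ ℕ.+ suc u) j) ⟩
      ∑< (l ℕ.+ suc u) (largestPart (2 ℕ.* j)) * middleSum (suc u)
        ≈⟨ ∑-largestPart-middleSum (2 ℕ.* j) u ⟩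
      transfer (2 ℕ.* j) (suc u) + transfer (2 ℕ.+ 2 ℕ.* j) u ∎

  column : ℕ → Carrier
  column m with l ≤? m
  ... | yes _ = sgn (m ∸ l) * middleSum (m ∸ l)
  ... | no  _ = 0#

  column-below : ∀ m → m < l → column m ≈ 0#
  column-below m m<l with l ≤? m
  ... | yes l≤m = ⊥-elim (ℕ.<⇒≱ m<l l≤m)
  ... | no  _   = refl

  column-above : ∀ m → l ≤ m → column m ≈ sgn (m ∸ l) * middleSum (m ∸ l)
  column-above m l≤m with l ≤? m
  ... | yes _   = refl
  ... | no  l≰m = ⊥-elim (l≰m l≤m)

  column-from : ∀ t → column (l ℕ.+ t) ≈ sgn t * middleSum t
  column-from t = ≡.subst (λ n → column (l ℕ.+ t) ≈ sgn n * middleSum n) (ℕ.m+n∸m≡n l t)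
                          (column-above (l ℕ.+ t) (ℕ.m≤m+n l t))

  δ-diag : ∀ i → δ R i i ≈ 1#
  δ-diag i with i ℕ.≟ i
  ... | yes _   = refl
  ... | no  i≢i = ⊥-elim (i≢i ≡.refl)

  δ-off : ∀ i j → i ≢ j → δ R i j ≈ 0#
  δ-off i j i≢j with i ℕ.≟ j
  ... | yes i≡j = ⊥-elim (i≢j i≡j)
  ... | no  _   = refl

  Hq-row·column-telescoped : ∀ T → sumTo R (l ℕ.+ T) (λ m → Hq R q (l ℕ.+ T) m * column m) ≈ sgn T * transfer 0 T
  Hq-row·column-telescoped T = begin
    sumTo R (l ℕ.+ T) (λ m → H m * column m)
      ≈⟨ sumTo≈∑< (l ℕ.+ T) _ ⟩
    ∑[ m < l ℕ.+ T ] (H (suc m) * column (suc m))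
      ≡⟨ ≡.cong (λ n → ∑[ m < n ] (H (suc m) * column (suc m))) (≡.sym (ℕ.+-suc l′ T)) ⟩
    ∑[ m < l′ ℕ.+ suc T ] (H (suc m) * column (suc m))
      ≈⟨ ∑<-+ l′ (suc T) _ ⟩
    ∑[ m < l′ ] (H (suc m) * column (suc m)) + ∑[ t < suc T ] (H (l ℕ.+ t) * column (l ℕ.+ t))
      ≈⟨ +-cong below (∑<-cong (suc T) (λ t _ → trans (*-congˡ (column-from t)) (*-Props.x∙yz≈y∙xz _ _ _))) ⟩
    0# + ∑[ t < suc T ] (sgn t * (H (l ℕ.+ t) * middleSum t))
      ≈⟨ +-identityˡ _ ⟩
    ∑[ t < suc T ] (sgn t * (H (l ℕ.+ t) * middleSum t))
      ≡⟨ ≡.cong (λ n → ∑[ t < suc T ] (sgn t * (Hq R q (l ℕ.+ n) (l ℕ.+ t) * middleSum t))) (≡.sym (ℕ.+-identityʳ T)) ⟩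
    ∑[ t < suc T ] (sgn t * (Hq R q (l ℕ.+ (T ℕ.+ 0)) (l ℕ.+ t) * middleSum t))
      ≈⟨ telescope T 0 ⟩
    sgn T * transfer 0 T ∎
    where
    module *-Props = CommSemigroupProperties *-commutativeSemigroup
    H : ℕ → Carrier
    H = Hq R q (l ℕ.+ T)
    below : ∑[ m < l′ ] (H (suc m) * column (suc m)) ≈ 0#
    below = trans (∑<-cong l′ (λ m m<l′ → trans (*-congˡ (column-below (suc m) (s≤s m<l′))) (zeroʳ _))) (∑<-zero l′)

  Hq-row·column-from : ∀ T → sumTo R (l ℕ.+ T) (λ m → Hq R q (l ℕ.+ T) m * column m) ≈ δ R (l ℕ.+ T) l
  Hq-row·column-from zero = begin
    _                                ≈⟨ Hq-row·column-telescoped 0 ⟩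
    1# * transfer 0 0                ≈⟨ *-identityˡ _ ⟩
    transfer 0 0                     ≈⟨ transfer-s-0 0 ⟩
    ∑< l (largestPart 0)             ≈⟨ ∑-largestPart 0 l′ ⟩
    1#                               ≈⟨ sym (δ-diag l) ⟩
    δ R l l                          ≡⟨ ≡.cong (λ i → δ R i l) (≡.sym (ℕ.+-identityʳ l)) ⟩
    δ R (l ℕ.+ 0) l                  ∎
  Hq-row·column-from (suc T) = begin
    _                                ≈⟨ Hq-row·column-telescoped (suc T) ⟩
    sgn (suc T) * transfer 0 (suc T) ≈⟨ trans (*-congˡ (transfer-0-suc T)) (zeroʳ _) ⟩
    0#                               ≈⟨ sym (δ-off (l ℕ.+ suc T) l (ℕ.m+1+n≢m l)) ⟩
    δ R (l ℕ.+ suc T) l              ∎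

  Hq-row·column : ∀ i → sumTo R i (λ m → Hq R q i m * column m) ≈ δ R i l
  Hq-row·column i with l ≤? i
  ... | yes l≤i = ≡.subst (λ i → sumTo R i (λ m → Hq R q i m * column m) ≈ δ R i l) (ℕ.m+[n∸m]≡n l≤i)
                          (Hq-row·column-from (i ∸ l))
  ... | no  l≰i = begin
    sumTo R i (λ m → Hq R q i m * column m)    ≈⟨ sumTo≈∑< i _ ⟩
    ∑[ m < i ] (Hq R q i (suc m) * column (suc m))
      ≈⟨ ∑<-cong i (λ m m<i → trans (*-congˡ (column-below (suc m) (ℕ.≤-<-trans m<i (ℕ.≰⇒> l≰i)))) (zeroʳ _)) ⟩
    ∑[ m < i ] 0#                              ≈⟨ ∑<-zero i ⟩
    0#                                         ≈⟨ sym (δ-off i l (λ i≡l → l≰i (ℕ.≤-reflexive (≡.sym i≡l)))) ⟩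
    δ R i l                                    ∎

  inverse-column : (M : ℕ → ℕ → Carrier) → IsInverseOfH R q M →
                   ∀ k → l ≤ k → M k l ≈ sgn (k ∸ l) * middleSum (k ∸ l)
  inverse-column M inv k l≤k =
    trans (solution-unique (Hq R q) Hq-diag (λ m → M m l) column
                           (λ i 1≤i → trans (inv i l 1≤i (s≤s z≤n)) (sym (Hq-row·column i)))
                           k (ℕ.≤-trans (s≤s z≤n) l≤k))
          (column-above k l≤k)

module LatticePaths where

  column row : Point → ℕ
  column = proj₁
  row    = proj₂

  east : ℕ → List Step
  east n = replicate n E

  -- `words` appends with a private copy of _++_, which only its two defining equations identify with _++_.
  ++-unique : ∀ {X : Set} {_⊕_ : List X → List X → List X} →
              (∀ ys → [] ⊕ ys ≡ ys) → (∀ x xs ys → (x ∷ xs) ⊕ ys ≡ x ∷ (xs ⊕ ys)) →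
              ∀ xs ys → xs ⊕ ys ≡ xs ++ ys
  ++-unique nil cons []       ys = nil ys
  ++-unique nil cons (x ∷ xs) ys = ≡.trans (cons x xs ys) (≡.cong (x ∷_) (++-unique nil cons xs ys))

  words-suc-suc : ∀ e s → words (suc e) (suc s) ≡ map (E ∷_) (words e (suc s)) ++ map (S ∷_) (words (suc e) s)
  words-suc-suc e s with ++-unique (λ _ → ≡.refl) (λ _ _ _ → ≡.refl)
                       | List (List Step) ∋ map (E ∷_) (words e (suc s))
                       | List (List Step) ∋ map (S ∷_) (words (suc e) s)
  ... | append≡++ | xs | ys = append≡++ xs ys

  words-zero : ∀ e → words e 0 ≡ east e ∷ []
  words-zero zero    = ≡.refl
  words-zero (suc e) = ≡.cong (map (E ∷_)) (words-zero e)

  paths-≤ : ∀ a b c d → a ≤ c → d ≤ b → paths (a , b) (c , d) ≡ map ((a , b) ,_) (words (c ∸ a) (b ∸ d))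
  paths-≤ a b c d a≤c d≤b with a ≤? c | d ≤? b
  ... | yes _   | yes _   = ≡.refl
  ... | no  a≰c | _       = ⊥-elim (a≰c a≤c)
  ... | yes _   | no  d≰b = ⊥-elim (d≰b d≤b)

  southSteps : List Step → ℕ
  southSteps []      = 0
  southSteps (E ∷ w) = southSteps w
  southSteps (S ∷ w) = suc (southSteps w)

  words-southSteps : ∀ e s → All (λ w → southSteps w ≡ s) (words e s)
  words-southSteps zero    zero    = ≡.refl ∷ []
  words-southSteps (suc e) zero    = All.map⁺ (words-southSteps e zero)
  words-southSteps zero    (suc s) = All.map⁺ (All.map (≡.cong suc) (words-southSteps zero s))
  words-southSteps (suc e) (suc s) rewrite words-suc-suc e s =
    All.++⁺ (All.map⁺ (words-southSteps e (suc s))) (All.map⁺ (All.map (≡.cong suc) (words-southSteps (suc e) s)))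

  RowsIn : ℕ → ℕ → Point → Set
  RowsIn lo hi p = lo ≤ row p × row p ≤ hi

  pointsFrom-rows : ∀ x y w → All (RowsIn (y ∸ southSteps w) y) (pointsFrom (x , y) w)
  pointsFrom-rows x y []      = (ℕ.≤-refl , ℕ.≤-refl) ∷ []
  pointsFrom-rows x y (E ∷ w) = (ℕ.m∸n≤m y (southSteps w) , ℕ.≤-refl) ∷ pointsFrom-rows (suc x) y w
  pointsFrom-rows x y (S ∷ w) =
    (ℕ.m∸n≤m y (suc (southSteps w)) , ℕ.≤-refl) ∷ All.map (λ {p} → lower {p}) (pointsFrom-rows x (y ∸ 1) w)
    where
    lower : ∀ {p} → RowsIn (y ∸ 1 ∸ southSteps w) (y ∸ 1) p → RowsIn (y ∸ suc (southSteps w)) y p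
    lower {p} (lo , hi) = ≡.subst (_≤ row p) (ℕ.∸-+-assoc y 1 (southSteps w)) lo , ℕ.≤-trans hi (ℕ.m∸n≤m y 1)

  paths-rows : ∀ s t → All (λ ω → All (RowsIn (row t) (row s)) (points ω)) (paths s t)
  paths-rows (a , b) (c , d) with a ≤? c | d ≤? b
  ... | yes _ | yes d≤b = All.map⁺ (All.map rowsOf (words-southSteps (c ∸ a) (b ∸ d)))
    where
    rowsOf : ∀ {w} → southSteps w ≡ b ∸ d → All (RowsIn d b) (pointsFrom (a , b) w)
    rowsOf {w} south≡ = ≡.subst (λ lo → All (RowsIn lo b) (pointsFrom (a , b) w))
                                (≡.trans (≡.cong (b ∸_) south≡) (ℕ.m∸[m∸n]≡n d≤b)) (pointsFrom-rows a b w)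
  ... | yes _ | no _ = []
  ... | no  _ | _    = []

  families-All : ∀ {p} {P : Path → Set p} es → All (λ e → All P (paths (proj₁ e) (proj₂ e))) es → All (All P) (families es)
  families-All []             _          = [] ∷ []
  families-All ((s , t) ∷ es) (Ps ∷ Pes) =
    All.concat⁺ (All.map⁺ (All.map (λ Pω → All.map⁺ (All.map (Pω ∷_) (families-All es Pes))) Ps))

  disjoint-by : ∀ {p q} {P : Point → Set p} {Q : Point → Set q} ω ω′ →
                All P (points ω) → All Q (points ω′) → (∀ z → P z → Q z → ⊥) → DisjointPaths ω ω′
  disjoint-by ω ω′ Pω Qω′ P∩Q = All.map (λ {z} Pz z∈ω′ → P∩Q z Pz (All.lookup Qω′ z∈ω′)) Pω

  Below Above : ℕ → Path → Set
  Below y ω = All (λ p → row p < y) (points ω)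
  Above y ω = All (λ p → y ≤ row p) (points ω)

  below-above-disjoint : ∀ y ω ω′ → Below y ω → Above y ω′ → DisjointPaths ω ω′
  below-above-disjoint y ω ω′ below above = disjoint-by ω ω′ below above (λ _ → ℕ.<⇒≱)

  families-below : ∀ y es → All (λ e → row (proj₁ e) < y) es → All (All (Below y)) (families es)
  families-below y es starts = families-All es
    (All.map (λ {e} start<y → All.map (All.map (λ r → ℕ.≤-<-trans (proj₂ r) start<y)) (paths-rows (proj₁ e) (proj₂ e))) starts)

  families-above : ∀ y es → All (λ e → y ≤ row (proj₂ e)) es → All (All (Above y)) (families es)
  families-above y es ends = families-All es
    (All.map (λ {e} y≤end → All.map (All.map (λ r → ℕ.≤-trans y≤end (proj₁ r))) (paths-rows (proj₁ e) (proj₂ e))) ends)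

  AllPairs-++⁻ : ∀ {a r} {A : Set a} {_~_ : A → A → Set r} xs {ys} → AllPairs _~_ (xs ++ ys) →
                 AllPairs _~_ xs × AllPairs _~_ ys × All (λ x → All (x ~_) ys) xs
  AllPairs-++⁻ []       pairs           = [] , pairs , []
  AllPairs-++⁻ (x ∷ xs) (x~xs++ys ∷ pairs) with AllPairs-++⁻ xs pairs
  ... | pairsˡ , pairsʳ , across = All.++⁻ˡ xs x~xs++ys ∷ pairsˡ , pairsʳ , All.++⁻ʳ xs x~xs++ys ∷ across

  totalArea-++ : ∀ Ω Ω′ → totalArea (Ω ++ Ω′) ≡ totalArea Ω ℕ.+ totalArea Ω′
  totalArea-++ []      Ω′ = ≡.refl
  totalArea-++ (ω ∷ Ω) Ω′ = ≡.trans (≡.cong (area ω ℕ.+_) (totalArea-++ Ω Ω′)) (≡.sym (ℕ.+-assoc (area ω) _ _))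

  range : ℕ → ℕ → List ℕ
  range a zero    = []
  range a (suc t) = a ∷ range (suc a) t

  range-+ : ∀ a t u → range a (t ℕ.+ u) ≡ range a t ++ range (a ℕ.+ t) u
  range-+ a zero    u rewrite ℕ.+-identityʳ a = ≡.refl
  range-+ a (suc t) u rewrite range-+ (suc a) t u | ℕ.+-suc a t = ≡.refl

  range-suc : ∀ a t → range a (suc t) ≡ range a t ++ (a ℕ.+ t) ∷ []
  range-suc a t = ≡.trans (≡.cong (range a) (ℕ.+-comm 1 t)) (range-+ a t 1)

  range-bounds : ∀ a t → All (λ i → a ≤ i × i < a ℕ.+ t) (range a t)
  range-bounds a zero    = []
  range-bounds a (suc t) = (ℕ.≤-refl , ℕ.m<m+n a (s≤s z≤n)) ∷ All.map shift (range-bounds (suc a) t)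
    where
    shift : ∀ {i} → suc a ≤ i × i < suc a ℕ.+ t → a ≤ i × i < a ℕ.+ suc t
    shift {i} (a<i , i<) = ℕ.<⇒≤ a<i , ≡.subst (i <_) (≡.sym (ℕ.+-suc a t)) i<

  applyUpTo-range : ∀ (f : ℕ → ℕ) a n → (∀ i → f i ≡ a ℕ.+ i) → applyUpTo f n ≡ range a n
  applyUpTo-range f a zero    f≗a+ = ≡.refl
  applyUpTo-range f a (suc n) f≗a+ =
    ≡.cong₂ _∷_ (≡.trans (f≗a+ 0) (ℕ.+-identityʳ a))
                (applyUpTo-range (λ i → f (suc i)) (suc a) n (λ i → ≡.trans (f≗a+ (suc i)) (ℕ.+-suc a i)))

  twoSouth : ℕ → ℕ → ℕ → List Step
  twoSouth e a b = east a ++ S ∷ east (b ∸ a) ++ S ∷ east (e ∸ b)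

  areaFrom-east-++ : ∀ off j w → areaFrom off (east j ++ w) ≡ areaFrom (off ℕ.+ j) w
  areaFrom-east-++ off zero    w = ≡.cong (λ o → areaFrom o w) (≡.sym (ℕ.+-identityʳ off))
  areaFrom-east-++ off (suc j) w = ≡.trans (areaFrom-east-++ (suc off) j w) (≡.cong (λ o → areaFrom o w) (≡.sym (ℕ.+-suc off j)))

  areaFrom-east : ∀ off j → areaFrom off (east j) ≡ 0
  areaFrom-east off zero    = ≡.refl
  areaFrom-east off (suc j) = areaFrom-east (suc off) j

  area-twoSouth : ∀ e a b → a ≤ b → areaFrom 0 (twoSouth e a b) ≡ a ℕ.+ b
  area-twoSouth e a b a≤b = begin
    areaFrom 0 (east a ++ S ∷ east (b ∸ a) ++ S ∷ east (e ∸ b))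
      ≡⟨ areaFrom-east-++ 0 a _ ⟩
    a ℕ.+ areaFrom a (east (b ∸ a) ++ S ∷ east (e ∸ b))
      ≡⟨ ≡.cong (a ℕ.+_) (areaFrom-east-++ a (b ∸ a) _) ⟩
    a ℕ.+ (a ℕ.+ (b ∸ a) ℕ.+ areaFrom (a ℕ.+ (b ∸ a)) (east (e ∸ b)))
      ≡⟨ ≡.cong (λ r → a ℕ.+ (a ℕ.+ (b ∸ a) ℕ.+ r)) (areaFrom-east _ (e ∸ b)) ⟩
    a ℕ.+ (a ℕ.+ (b ∸ a) ℕ.+ 0)
      ≡⟨ ≡.cong (a ℕ.+_) (≡.trans (ℕ.+-identityʳ _) (ℕ.m+[n∸m]≡n a≤b)) ⟩
    a ℕ.+ b ∎
    where open ≡.≡-Reasoning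

  All-pointsFrom-east-++ : ∀ {p} {P : Point → Set p} j x y w → (∀ u → x ≤ u → u < x ℕ.+ j → P (u , y)) →
                           All P (pointsFrom (x ℕ.+ j , y) w) → All P (pointsFrom (x , y) (east j ++ w))
  All-pointsFrom-east-++ {P = P} zero x y w _ Pw = ≡.subst (λ x′ → All P (pointsFrom (x′ , y) w)) (ℕ.+-identityʳ x) Pw
  All-pointsFrom-east-++ {P = P} (suc j) x y w Pseg Pw =
    Pseg x ℕ.≤-refl (ℕ.m<m+n x (s≤s z≤n)) ∷
    All-pointsFrom-east-++ j (suc x) y w (λ u x<u u< → Pseg u (ℕ.<⇒≤ x<u) (≡.subst (u <_) (≡.sym (ℕ.+-suc x j)) u<))
                                         (≡.subst (λ x′ → All P (pointsFrom (x′ , y) w)) (ℕ.+-suc x j) Pw)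

  pointsFrom-columns : ∀ x y w → All (λ p → x ≤ column p) (pointsFrom (x , y) w)
  pointsFrom-columns x y []      = ℕ.≤-refl ∷ []
  pointsFrom-columns x y (E ∷ w) = ℕ.≤-refl ∷ All.map ℕ.<⇒≤ (pointsFrom-columns (suc x) y w)
  pointsFrom-columns x y (S ∷ w) = ℕ.≤-refl ∷ pointsFrom-columns x (y ∸ 1) w

  pointsFrom-east-row : ∀ x y j → All (λ p → row p ≡ y) (pointsFrom (x , y) (east j))
  pointsFrom-east-row x y zero    = ≡.refl ∷ []
  pointsFrom-east-row x y (suc j) = ≡.refl ∷ pointsFrom-east-row (suc x) y j

  ∈-pointsFrom-start : ∀ p w → p ∈ pointsFrom p w
  ∈-pointsFrom-start p       []      = here ≡.refl
  ∈-pointsFrom-start (x , y) (E ∷ w) = here ≡.refl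
  ∈-pointsFrom-start (x , y) (S ∷ w) = here ≡.refl

  ∈-pointsFrom-east-++ˡ : ∀ u j x y w → u ≤ j → (x ℕ.+ u , y) ∈ pointsFrom (x , y) (east j ++ w)
  ∈-pointsFrom-east-++ˡ zero    j       x y w _         =
    ≡.subst (λ x′ → (x′ , y) ∈ pointsFrom (x , y) (east j ++ w)) (≡.sym (ℕ.+-identityʳ x))
            (∈-pointsFrom-start (x , y) (east j ++ w))
  ∈-pointsFrom-east-++ˡ (suc u) (suc j) x y w (s≤s u≤j) =
    there (≡.subst (λ x′ → (x′ , y) ∈ pointsFrom (suc x , y) (east j ++ w)) (≡.sym (ℕ.+-suc x u))
                   (∈-pointsFrom-east-++ˡ u j (suc x) y w u≤j))

  ∈-pointsFrom-east-++ʳ : ∀ {z} j x y w → z ∈ pointsFrom (x ℕ.+ j , y) w → z ∈ pointsFrom (x , y) (east j ++ w)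
  ∈-pointsFrom-east-++ʳ {z} zero    x y w z∈ = ≡.subst (λ x′ → z ∈ pointsFrom (x′ , y) w) (ℕ.+-identityʳ x) z∈
  ∈-pointsFrom-east-++ʳ {z} (suc j) x y w z∈ =
    there (∈-pointsFrom-east-++ʳ j (suc x) y w (≡.subst (λ x′ → z ∈ pointsFrom (x′ , y) w) (ℕ.+-suc x j) z∈))

  LowerSide UpperSide : ℕ → ℕ → Point → Set
  LowerSide y a′ p = row p ≤ y × (row p ≡ y → column p ≤ a′)
  UpperSide y b  p = y ≤ row p × (row p ≡ y → b ≤ column p)

  twoSouth-lowerSide : ∀ y e a′ b′ → 1 ≤ y → All (LowerSide y a′) (pointsFrom (0 , y) (twoSouth e a′ b′))
  twoSouth-lowerSide y e a′ b′ 1≤y =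
    All-pointsFrom-east-++ a′ 0 y _ (λ u _ u<a′ → ℕ.≤-refl , λ _ → ℕ.<⇒≤ u<a′)
      ((ℕ.≤-refl , λ _ → ℕ.≤-refl) ∷
       All.map strictlyBelow (pointsFrom-rows a′ (y ∸ 1) (east (b′ ∸ a′) ++ S ∷ east (e ∸ b′))))
    where
    y-1<y : y ∸ 1 < y
    y-1<y = ℕ.∸-monoʳ-< {o = 0} (s≤s z≤n) 1≤y
    strictlyBelow : ∀ {p} → RowsIn _ (y ∸ 1) p → LowerSide y a′ p
    strictlyBelow (_ , r≤y-1) =
      ℕ.≤-trans r≤y-1 (ℕ.m∸n≤m y 1) , λ r≡y → ⊥-elim (ℕ.<⇒≱ (ℕ.≤-<-trans r≤y-1 y-1<y) (ℕ.≤-reflexive (≡.sym r≡y)))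

  twoSouth-upperSide : ∀ y e a b → a ≤ b → All (UpperSide y b) (pointsFrom (0 , 2 ℕ.+ y) (twoSouth e a b))
  twoSouth-upperSide y e a b a≤b =
    All-pointsFrom-east-++ a 0 (2 ℕ.+ y) _ (λ _ _ _ → top) (top ∷
      All-pointsFrom-east-++ (b ∸ a) a (suc y) _ (λ _ _ _ → middle) (middle ∷
        All.zipWith bottom (pointsFrom-columns (a ℕ.+ (b ∸ a)) y (east (e ∸ b)) , pointsFrom-east-row (a ℕ.+ (b ∸ a)) y (e ∸ b))))
    where
    top : ∀ {x} → UpperSide y b (x , 2 ℕ.+ y)
    top = ℕ.≤-trans (ℕ.n≤1+n y) (ℕ.n≤1+n (suc y)) , λ 2+y≡y → ⊥-elim (ℕ.m+1+n≢m y (≡.trans (ℕ.+-comm y 2) 2+y≡y))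
    middle : ∀ {x} → UpperSide y b (x , suc y)
    middle = ℕ.n≤1+n y , λ 1+y≡y → ⊥-elim (ℕ.m+1+n≢m y (≡.trans (ℕ.+-comm y 1) 1+y≡y))
    bottom : ∀ {p} → a ℕ.+ (b ∸ a) ≤ column p × row p ≡ y → UpperSide y b p
    bottom {p} (b≤col , r≡y) = ℕ.≤-reflexive (≡.sym r≡y) , λ _ → ≡.subst (_≤ column p) (ℕ.m+[n∸m]≡n a≤b) b≤col

  twoSouth-∈-lower : ∀ y e a′ b′ b → b ≤ a′ → (b , y) ∈ pointsFrom (0 , y) (twoSouth e a′ b′)
  twoSouth-∈-lower y e a′ b′ b b≤a′ = ∈-pointsFrom-east-++ˡ b a′ 0 y _ b≤a′

  twoSouth-∈-upper : ∀ y e a b → a ≤ b → (b , y) ∈ pointsFrom (0 , 2 ℕ.+ y) (twoSouth e a b)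
  twoSouth-∈-upper y e a b a≤b =
    ∈-pointsFrom-east-++ʳ a 0 (2 ℕ.+ y) _ (there (
      ∈-pointsFrom-east-++ʳ (b ∸ a) a (suc y) _ (there (
        ≡.subst (λ x → (b , y) ∈ pointsFrom (x , y) (east (e ∸ b))) (≡.sym (ℕ.m+[n∸m]≡n a≤b))
                (∈-pointsFrom-start (b , y) (east (e ∸ b)))))))

  twoSouth-disjoint⇒ : ∀ y e′ a′ b′ e a b → a ≤ b →
                       DisjointPaths ((0 , y) , twoSouth e′ a′ b′) ((0 , 2 ℕ.+ y) , twoSouth e a b) → a′ < b
  twoSouth-disjoint⇒ y e′ a′ b′ e a b a≤b disjoint with a′ <? b
  ... | yes a′<b = a′<b
  ... | no  a′≮b =
    ⊥-elim (All.lookup disjoint (twoSouth-∈-lower y e′ a′ b′ b (ℕ.≮⇒≥ a′≮b)) (twoSouth-∈-upper y e a b a≤b))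

  -- The two paths can only meet on row y, where the lower one covers the columns ≤ a′ and the upper one those ≥ b.
  twoSouth-disjoint⇐ : ∀ y e′ a′ b′ e a b → 1 ≤ y → a ≤ b → a′ < b →
                       DisjointPaths ((0 , y) , twoSouth e′ a′ b′) ((0 , 2 ℕ.+ y) , twoSouth e a b)
  twoSouth-disjoint⇐ y e′ a′ b′ e a b 1≤y a≤b a′<b =
    disjoint-by ((0 , y) , twoSouth e′ a′ b′) ((0 , 2 ℕ.+ y) , twoSouth e a b)
      (twoSouth-lowerSide y e′ a′ b′ 1≤y) (twoSouth-upperSide y e a b a≤b)
      (λ _ (r≤y , lowCol) (y≤r , highCol) →
         let r≡y = ℕ.≤-antisym r≤y y≤r in ℕ.<⇒≱ a′<b (ℕ.≤-trans (highCol r≡y) (lowCol r≡y)))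

  2*suc∸2 : ∀ j → 2 ℕ.* suc j ∸ 2 ≡ 2 ℕ.* j
  2*suc∸2 j = ≡.cong (_∸ 2) (ℕ.*-suc 2 j)

  2*∸2-mono-≤ : ∀ {i j} → i ≤ j → 2 ℕ.* i ∸ 2 ≤ 2 ℕ.* j ∸ 2
  2*∸2-mono-≤ i≤j = ℕ.∸-monoˡ-≤ 2 (ℕ.*-monoʳ-≤ 2 i≤j)

  2*∸2-mono-< : ∀ {i j} → 1 ≤ i → i < j → 2 ℕ.* i ∸ 2 < 2 ℕ.* j ∸ 2
  2*∸2-mono-< {suc i} {suc j} _ (s≤s i<j) rewrite 2*suc∸2 i | 2*suc∸2 j = ℕ.*-monoʳ-< 2 i<j

  horizontal middle : ℕ → Point × Point
  horizontal i = (A i , B i)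
  middle     i = (A (suc i) , B i)

  paths-horizontal : ∀ i → paths (A i) (B i) ≡ (A i , east (i ∸ 1)) ∷ []
  paths-horizontal i = begin
    paths (0 , y) (i ∸ 1 , y)                   ≡⟨ paths-≤ 0 y (i ∸ 1) y z≤n ℕ.≤-refl ⟩
    map ((0 , y) ,_) (words (i ∸ 1) (y ∸ y))    ≡⟨ ≡.cong (λ s → map ((0 , y) ,_) (words (i ∸ 1) s)) (ℕ.n∸n≡0 y) ⟩
    map ((0 , y) ,_) (words (i ∸ 1) 0)          ≡⟨ ≡.cong (map ((0 , y) ,_)) (words-zero (i ∸ 1)) ⟩
    (A i , east (i ∸ 1)) ∷ []                   ∎
    where
    open ≡.≡-Reasoning
    y : ℕ
    y = 2 ℕ.* i ∸ 2

  -- the path ω_(n+1) : A (n + 2) → B (n + 1) with south steps in columns a ≤ b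
  middlePath : ℕ → ℕ → ℕ → Path
  middlePath n a b = (0 , 2 ℕ.* suc n) , twoSouth n a b

  paths-middle : ∀ n → paths (A (2 ℕ.+ n)) (B (suc n)) ≡ map ((0 , 2 ℕ.* suc n) ,_) (words n 2)
  paths-middle n = begin
    paths (A (2 ℕ.+ n)) (B (suc n))
      ≡⟨ ≡.cong₂ (λ y y′ → paths (0 , y) (n , y′)) (2*suc∸2 (suc n)) (2*suc∸2 n) ⟩
    paths (0 , 2 ℕ.* suc n) (n , 2 ℕ.* n)
      ≡⟨ paths-≤ 0 (2 ℕ.* suc n) n (2 ℕ.* n) z≤n (ℕ.*-monoʳ-≤ 2 (ℕ.n≤1+n n)) ⟩
    map ((0 , 2 ℕ.* suc n) ,_) (words n (2 ℕ.* suc n ∸ 2 ℕ.* n))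
      ≡⟨ ≡.cong (λ s → map ((0 , 2 ℕ.* suc n) ,_) (words n (s ∸ 2 ℕ.* n))) (ℕ.*-suc 2 n) ⟩
    map ((0 , 2 ℕ.* suc n) ,_) (words n (2 ℕ.+ 2 ℕ.* n ∸ 2 ℕ.* n))
      ≡⟨ ≡.cong (λ s → map ((0 , 2 ℕ.* suc n) ,_) (words n s)) (ℕ.m+n∸n≡m 2 (2 ℕ.* n)) ⟩
    map ((0 , 2 ℕ.* suc n) ,_) (words n 2) ∎
    where open ≡.≡-Reasoning

  indicesWithout-split : ∀ n m → suc m ≤ n → indicesWithout n (suc m) ≡ range 1 m ++ range (2 ℕ.+ m) (n ∸ suc m)
  indicesWithout-split n m k≤n = begin
    filter ≢k? (map suc (upTo n))
      ≡⟨ ≡.cong (filter ≢k?) (≡.trans (map-applyUpTo (λ i → i) suc n) (applyUpTo-range suc 1 n (λ _ → ≡.refl))) ⟩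
    filter ≢k? (range 1 n)
      ≡⟨ ≡.cong (λ n′ → filter ≢k? (range 1 n′)) n≡ ⟩
    filter ≢k? (range 1 (m ℕ.+ suc (n ∸ suc m)))
      ≡⟨ ≡.cong (filter ≢k?) (range-+ 1 m (suc (n ∸ suc m))) ⟩
    filter ≢k? (range 1 m ++ suc m ∷ range (2 ℕ.+ m) (n ∸ suc m))
      ≡⟨ filter-++ ≢k? (range 1 m) _ ⟩
    filter ≢k? (range 1 m) ++ filter ≢k? (suc m ∷ range (2 ℕ.+ m) (n ∸ suc m))
      ≡⟨ ≡.cong₂ _++_ (filter-all ≢k? before) (≡.trans (filter-reject ≢k? (λ k≢k → k≢k ≡.refl)) (filter-all ≢k? after)) ⟩
    range 1 m ++ range (2 ℕ.+ m) (n ∸ suc m) ∎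
    where
    open ≡.≡-Reasoning
    ≢k? : ∀ i → Dec (i ≢ suc m)
    ≢k? i = ¬? (i ℕ.≟ suc m)
    n≡ : n ≡ m ℕ.+ suc (n ∸ suc m)
    n≡ = ≡.sym (≡.trans (ℕ.+-suc m (n ∸ suc m)) (ℕ.m+[n∸m]≡n k≤n))
    before : All (_≢ suc m) (range 1 m)
    before = All.map (λ bounds i≡k → ℕ.<-irrefl i≡k (proj₂ bounds)) (range-bounds 1 m)
    after : All (_≢ suc m) (range (2 ℕ.+ m) (n ∸ suc m))
    after = All.map (λ bounds i≡k → ℕ.<-irrefl (≡.sym i≡k) (proj₁ bounds)) (range-bounds (2 ℕ.+ m) (n ∸ suc m))

  module _ (k l : ℕ) where

    endpoint-below : ∀ i → i < l → endpoint k l i ≡ horizontal i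
    endpoint-below i i<l with l ≤? i | i <? k
    ... | yes l≤i | _     = ⊥-elim (ℕ.<⇒≱ i<l l≤i)
    ... | no  _   | yes _ = ≡.refl
    ... | no  _   | no  _ = ≡.refl

    endpoint-between : ∀ i → l ≤ i → i < k → endpoint k l i ≡ middle i
    endpoint-between i l≤i i<k with l ≤? i | i <? k
    ... | yes _   | yes _   = ≡.refl
    ... | no  l≰i | _       = ⊥-elim (l≰i l≤i)
    ... | yes _   | no  i≮k = ⊥-elim (i≮k i<k)

    endpoint-above : ∀ i → k < i → endpoint k l i ≡ horizontal i
    endpoint-above i k<i with l ≤? i | i <? k
    ... | yes _ | yes i<k = ⊥-elim (ℕ.<-asym i<k k<i)
    ... | yes _ | no  _   = ≡.refl
    ... | no  _ | _       = ≡.refl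

  endpoints-split : ∀ n l′ T → let l = suc l′; k = l ℕ.+ T in k ≤ n →
                    endpoints n k l ≡ map horizontal (range 1 l′) ++ (map middle (range l T) ++ map horizontal (range (suc k) (n ∸ k)))
  endpoints-split n l′ T k≤n = begin
    map (endpoint k l) (indicesWithout n k)
      ≡⟨ ≡.cong (map (endpoint k l)) (indicesWithout-split n (l′ ℕ.+ T) k≤n) ⟩
    map (endpoint k l) (range 1 (l′ ℕ.+ T) ++ high)
      ≡⟨ ≡.cong (λ is → map (endpoint k l) (is ++ high)) (range-+ 1 l′ T) ⟩
    map (endpoint k l) ((range 1 l′ ++ range l T) ++ high)
      ≡⟨ ≡.cong (map (endpoint k l)) (++-assoc (range 1 l′) (range l T) high) ⟩
    map (endpoint k l) (range 1 l′ ++ range l T ++ high)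
      ≡⟨ ≡.trans (map-++ (endpoint k l) (range 1 l′) _)
                 (≡.cong (map (endpoint k l) (range 1 l′) ++_) (map-++ (endpoint k l) (range l T) high)) ⟩
    map (endpoint k l) (range 1 l′) ++ map (endpoint k l) (range l T) ++ map (endpoint k l) high
      ≡⟨ ≡.cong₂ _++_ (map-cong-local (All.map (λ {i} b → endpoint-below k l i (proj₂ b)) (range-bounds 1 l′)))
                      (≡.cong₂ _++_ (map-cong-local (All.map (λ {i} b → endpoint-between k l i (proj₁ b) (proj₂ b)) (range-bounds l T)))
                                    (map-cong-local (All.map (λ {i} b → endpoint-above k l i (proj₁ b)) (range-bounds (suc k) (n ∸ k))))) ⟩
    map horizontal (range 1 l′) ++ map middle (range l T) ++ map horizontal high ∎
    where
    open ≡.≡-Reasoning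
    l k : ℕ
    l = suc l′
    k = l ℕ.+ T
    high : List ℕ
    high = range (suc k) (n ∸ k)

module FamilySums {c ℓ : Level} (R : CommutativeRing c ℓ) (q : CommutativeRing.Carrier R) where

  open CommutativeRing R hiding (zero)
  open RingLemmas R
  open GaussianBinomials R q using (q^_)
  open LatticePaths
  open SetoidReasoning setoid

  private
    module *-Props = CommSemigroupProperties *-commutativeSemigroup
    module Ring-Solver = NaturalSolver commutativeSemiring

  familyWeight : List Path → Carrier
  familyWeight Ω = 𝟙 (pairwiseDisjoint? Ω) * ψ R q Ω

  weight : List (Point × Point) → Carrier
  weight es = ∑[ Ω ∈ families es ] familyWeight Ω

  Avoids : List Path → Path → Set
  Avoids Ω ω = All (λ ω′ → DisjointPaths ω′ ω) Ω

  avoids? : ∀ Ω ω → Dec (Avoids Ω ω)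
  avoids? Ω ω = All.all? (λ ω′ → disjointPaths? ω′ ω) Ω

  avoidingWeight : Path → List Path → Carrier
  avoidingWeight ω Ω = 𝟙 (pairwiseDisjoint? Ω) * (𝟙 (avoids? Ω ω) * ψ R q Ω)

  weightAvoiding : List (Point × Point) → Path → Carrier
  weightAvoiding es ω = ∑[ Ω ∈ families es ] avoidingWeight ω Ω

  ∑-families-++ : ∀ es fs (F : List Path → Carrier) →
                  ∑∈ (families (es ++ fs)) F ≈ ∑[ Ω ∈ families es ] ∑[ Ω′ ∈ families fs ] F (Ω ++ Ω′)
  ∑-families-++ []             fs F = sym (+-identityʳ _)
  ∑-families-++ ((s , t) ∷ es) fs F = begin
    ∑∈ (concatMap (λ ω → map (ω ∷_) (families (es ++ fs))) (paths s t)) F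
      ≈⟨ ∑∈-concatMap _ (paths s t) F ⟩
    ∑[ ω ∈ paths s t ] ∑∈ (map (ω ∷_) (families (es ++ fs))) F
      ≈⟨ ∑∈-cong (paths s t) (λ ω → trans (∑∈-map (ω ∷_) (families (es ++ fs)) F)
                                          (∑-families-++ es fs (λ Ω → F (ω ∷ Ω)))) ⟩
    ∑[ ω ∈ paths s t ] ∑[ Ω ∈ families es ] ∑[ Ω′ ∈ families fs ] F (ω ∷ Ω ++ Ω′)
      ≈⟨ sym (∑∈-cong (paths s t) (λ ω → ∑∈-map (ω ∷_) (families es) _)) ⟩
    ∑[ ω ∈ paths s t ] ∑[ Ω ∈ map (ω ∷_) (families es) ] ∑[ Ω′ ∈ families fs ] F (Ω ++ Ω′)
      ≈⟨ sym (∑∈-concatMap _ (paths s t) _) ⟩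
    ∑[ Ω ∈ concatMap (λ ω → map (ω ∷_) (families es)) (paths s t) ] ∑[ Ω′ ∈ families fs ] F (Ω ++ Ω′) ∎

  ∑-families-[_] : ∀ st (F : List Path → Carrier) →
                   ∑∈ (families (st ∷ [])) F ≈ ∑[ ω ∈ paths (proj₁ st) (proj₂ st) ] F (ω ∷ [])
  ∑-families-[ s , t ] F = trans (∑∈-concatMap _ (paths s t) F) (∑∈-cong (paths s t) (λ ω → +-identityʳ _))

  ∑-families-snoc : ∀ es s t (F : List Path → Carrier) →
                    ∑∈ (families (es ++ (s , t) ∷ [])) F ≈ ∑[ ω ∈ paths s t ] ∑[ Ω ∈ families es ] F (Ω ++ ω ∷ [])
  ∑-families-snoc es s t F =
    trans (∑-families-++ es _ F)
          (trans (∑∈-cong (families es) (λ Ω → ∑-families-[ s , t ] _)) (∑∈-comm (families es) (paths s t) _))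

  ψ-++ : ∀ Ω Ω′ → ψ R q (Ω ++ Ω′) ≈ ψ R q Ω * ψ R q Ω′
  ψ-++ Ω Ω′ = trans (reflexive (≡.cong q^_ (totalArea-++ Ω Ω′))) (pow-+ q (totalArea Ω) (totalArea Ω′))

  ψ-snoc : ∀ Ω ω → ψ R q (Ω ++ ω ∷ []) ≈ ψ R q Ω * q^ area ω
  ψ-snoc Ω ω = trans (ψ-++ Ω (ω ∷ [])) (*-congˡ (reflexive (≡.cong q^_ (ℕ.+-identityʳ (area ω)))))

  𝟙-pairwiseDisjoint-snoc : ∀ Ω ω → 𝟙 (pairwiseDisjoint? (Ω ++ ω ∷ [])) ≈ 𝟙 (pairwiseDisjoint? Ω) * 𝟙 (avoids? Ω ω)
  𝟙-pairwiseDisjoint-snoc Ω ω = 𝟙-∧ (pairwiseDisjoint? (Ω ++ ω ∷ [])) (pairwiseDisjoint? Ω) (avoids? Ω ω)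
    (λ disjoint → let (pairs , _ , across) = AllPairs-++⁻ Ω disjoint in pairs , All.map All.head across)
    (λ pairs avoids → AllPairs.++⁺ pairs ([] ∷ []) (All.map (_∷ []) avoids))

  weight-++ : ∀ y es fs → All (λ e → row (proj₁ e) < y) es → All (λ e → y ≤ row (proj₂ e)) fs →
              weight (es ++ fs) ≈ weight es * weight fs
  weight-++ y es fs starts ends = begin
    weight (es ++ fs)
      ≈⟨ ∑-families-++ es fs _ ⟩
    ∑[ Ω ∈ families es ] ∑[ Ω′ ∈ families fs ] familyWeight (Ω ++ Ω′)
      ≈⟨ ∑∈-congᴬ (families es) (families-below y es starts) (λ Ω below →
           ∑∈-congᴬ (families fs) (families-above y fs ends) (λ Ω′ above → split Ω Ω′ (across Ω Ω′ below above))) ⟩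
    ∑[ Ω ∈ families es ] ∑[ Ω′ ∈ families fs ] (familyWeight Ω * familyWeight Ω′)
      ≈⟨ sym (∑∈-cong (families es) (λ Ω → *-distribˡ-∑∈ (families fs) _ _)) ⟩
    ∑[ Ω ∈ families es ] (familyWeight Ω * weight fs)
      ≈⟨ sym (*-distribʳ-∑∈ (families es) _ _) ⟩
    weight es * weight fs ∎
    where
    across : ∀ Ω Ω′ → All (Below y) Ω → All (Above y) Ω′ → All (λ ω → All (DisjointPaths ω) Ω′) Ω
    across Ω Ω′ below above = All.map (λ {ω} ω-below → All.map (λ {ω′} → below-above-disjoint y ω ω′ ω-below) above) below
    split : ∀ Ω Ω′ → All (λ ω → All (DisjointPaths ω) Ω′) Ω →
            familyWeight (Ω ++ Ω′) ≈ familyWeight Ω * familyWeight Ω′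
    split Ω Ω′ disjoint = trans (*-cong indicator (ψ-++ Ω Ω′)) (*-Props.interchange _ _ _ _)
      where
      indicator : 𝟙 (pairwiseDisjoint? (Ω ++ Ω′)) ≈ 𝟙 (pairwiseDisjoint? Ω) * 𝟙 (pairwiseDisjoint? Ω′)
      indicator = 𝟙-∧ (pairwiseDisjoint? (Ω ++ Ω′)) (pairwiseDisjoint? Ω) (pairwiseDisjoint? Ω′)
                      (λ d → let (pairs , pairs′ , _) = AllPairs-++⁻ Ω d in pairs , pairs′)
                      (λ pairs pairs′ → AllPairs.++⁺ pairs pairs′ disjoint)

  weight-snoc : ∀ es s t → weight (es ++ (s , t) ∷ []) ≈ ∑[ ω ∈ paths s t ] (q^ area ω * weightAvoiding es ω)
  weight-snoc es s t = begin
    weight (es ++ (s , t) ∷ [])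
      ≈⟨ ∑-families-snoc es s t _ ⟩
    ∑[ ω ∈ paths s t ] ∑[ Ω ∈ families es ] familyWeight (Ω ++ ω ∷ [])
      ≈⟨ ∑∈-cong (paths s t) (λ ω → ∑∈-cong (families es) (λ Ω → rearrange Ω ω)) ⟩
    ∑[ ω ∈ paths s t ] ∑[ Ω ∈ families es ] (q^ area ω * avoidingWeight ω Ω)
      ≈⟨ sym (∑∈-cong (paths s t) (λ ω → *-distribˡ-∑∈ (families es) _ _)) ⟩
    ∑[ ω ∈ paths s t ] (q^ area ω * weightAvoiding es ω) ∎
    where
    open Ring-Solver
    rearrange : ∀ Ω ω → familyWeight (Ω ++ ω ∷ []) ≈ q^ area ω * avoidingWeight ω Ω
    rearrange Ω ω = trans (*-cong (𝟙-pairwiseDisjoint-snoc Ω ω) (ψ-snoc Ω ω))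
                          (solve 4 (λ d a p x → (d :* a) :* (p :* x) := x :* (d :* (a :* p))) refl _ _ _ _)

  weightAvoiding-snoc : ∀ es s t ω → All (λ Ω → Avoids Ω ω) (families es) →
                        weightAvoiding (es ++ (s , t) ∷ []) ω
                          ≈ ∑[ ω′ ∈ paths s t ] (𝟙 (disjointPaths? ω′ ω) * (q^ area ω′ * weightAvoiding es ω′))
  weightAvoiding-snoc es s t ω avoided = begin
    weightAvoiding (es ++ (s , t) ∷ []) ω
      ≈⟨ ∑-families-snoc es s t _ ⟩
    ∑[ ω′ ∈ paths s t ] ∑[ Ω ∈ families es ] avoidingWeight ω (Ω ++ ω′ ∷ [])
      ≈⟨ ∑∈-cong (paths s t) (λ ω′ → ∑∈-congᴬ (families es) avoided (λ Ω → rearrange Ω ω′)) ⟩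
    ∑[ ω′ ∈ paths s t ] ∑[ Ω ∈ families es ] (𝟙 (disjointPaths? ω′ ω) * (q^ area ω′ * avoidingWeight ω′ Ω))
      ≈⟨ sym (∑∈-cong (paths s t) (λ ω′ → trans (*-congˡ (*-distribˡ-∑∈ (families es) _ _))
                                                (*-distribˡ-∑∈ (families es) _ _))) ⟩
    ∑[ ω′ ∈ paths s t ] (𝟙 (disjointPaths? ω′ ω) * (q^ area ω′ * weightAvoiding es ω′)) ∎
    where
    open Ring-Solver
    avoids-snoc : ∀ Ω ω′ → Avoids Ω ω → 𝟙 (avoids? (Ω ++ ω′ ∷ []) ω) ≈ 𝟙 (disjointPaths? ω′ ω)
    avoids-snoc Ω ω′ Ω-avoids = 𝟙-⇔ (avoids? (Ω ++ ω′ ∷ []) ω) (disjointPaths? ω′ ω)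
                                    (λ avoids → All.head (All.++⁻ʳ Ω avoids)) (λ d → All.++⁺ Ω-avoids (d ∷ []))
    rearrange : ∀ Ω ω′ → Avoids Ω ω →
                avoidingWeight ω (Ω ++ ω′ ∷ []) ≈ 𝟙 (disjointPaths? ω′ ω) * (q^ area ω′ * avoidingWeight ω′ Ω)
    rearrange Ω ω′ Ω-avoids =
      trans (*-cong (𝟙-pairwiseDisjoint-snoc Ω ω′) (*-cong (avoids-snoc Ω ω′ Ω-avoids) (ψ-snoc Ω ω′)))
            (solve 5 (λ d a e p x → (d :* a) :* (e :* (p :* x)) := e :* (x :* (d :* (a :* p)))) refl _ _ _ _ _)

  weight-[] : weight [] ≈ 1#
  weight-[] = trans (+-identityʳ _) (trans (*-congʳ (𝟙-yes (pairwiseDisjoint? []) [])) (*-identityˡ 1#))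

  weight-horizontal : ∀ i → weight (horizontal i ∷ []) ≈ 1#
  weight-horizontal i = begin
    weight (horizontal i ∷ [])
      ≈⟨ ∑-families-[ horizontal i ] _ ⟩
    ∑[ ω ∈ paths (A i) (B i) ] (𝟙 (pairwiseDisjoint? (ω ∷ [])) * ψ R q (ω ∷ []))
      ≡⟨ ≡.cong (λ ωs → ∑[ ω ∈ ωs ] (𝟙 (pairwiseDisjoint? (ω ∷ [])) * ψ R q (ω ∷ []))) (paths-horizontal i) ⟩
    𝟙 (pairwiseDisjoint? (ω ∷ [])) * ψ R q (ω ∷ []) + 0#
      ≈⟨ +-identityʳ _ ⟩
    𝟙 (pairwiseDisjoint? (ω ∷ [])) * ψ R q (ω ∷ [])
      ≈⟨ *-cong (𝟙-yes (pairwiseDisjoint? (ω ∷ [])) ([] ∷ [])) (reflexive (≡.cong q^_ flat)) ⟩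
    1# * 1#
      ≈⟨ *-identityˡ 1# ⟩
    1# ∎
    where
    ω : Path
    ω = (A i , east (i ∸ 1))
    flat : totalArea (ω ∷ []) ≡ 0
    flat = ≡.trans (ℕ.+-identityʳ _) (areaFrom-east 0 (i ∸ 1))

  weight-horizontals : ∀ a t → 1 ≤ a → weight (map horizontal (range a t)) ≈ 1#
  weight-horizontals a zero    _   = weight-[]
  weight-horizontals a (suc t) 1≤a = begin
    weight (map horizontal (range a (suc t)))
      ≡⟨ ≡.cong weight (≡.trans (≡.cong (map horizontal) (range-suc a t)) (map-++ horizontal (range a t) _)) ⟩
    weight (map horizontal (range a t) ++ horizontal (a ℕ.+ t) ∷ [])
      ≈⟨ weight-++ (2 ℕ.* (a ℕ.+ t) ∸ 2) (map horizontal (range a t)) _ below (ℕ.≤-refl ∷ []) ⟩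
    weight (map horizontal (range a t)) * weight (horizontal (a ℕ.+ t) ∷ [])
      ≈⟨ *-cong (weight-horizontals a t 1≤a) (weight-horizontal (a ℕ.+ t)) ⟩
    1# * 1#
      ≈⟨ *-identityˡ 1# ⟩
    1# ∎
    where
    below : All (λ e → row (proj₁ e) < 2 ℕ.* (a ℕ.+ t) ∸ 2) (map horizontal (range a t))
    below = All.map⁺ (All.map (λ b → 2*∸2-mono-< (ℕ.≤-trans 1≤a (proj₁ b)) (proj₂ b)) (range-bounds a t))

  ∑-words-1 : ∀ e (f : List Step → Carrier) → ∑∈ (words e 1) f ≈ ∑[ b < suc e ] f (east b ++ S ∷ east (e ∸ b))
  ∑-words-1 zero    f = +-comm _ _
  ∑-words-1 (suc e) f rewrite words-suc-suc e 0 | words-zero e = begin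
    ∑∈ (map (E ∷_) (words e 1) ++ map (S ∷_) (map (E ∷_) (east e ∷ []))) f
      ≈⟨ ∑∈-++ (map (E ∷_) (words e 1)) _ f ⟩
    ∑∈ (map (E ∷_) (words e 1)) f + (f (S ∷ east (suc e)) + 0#)
      ≈⟨ +-cong (trans (∑∈-map (E ∷_) (words e 1) f) (∑-words-1 e (λ w → f (E ∷ w)))) (+-identityʳ _) ⟩
    ∑[ b < suc e ] f (E ∷ east b ++ S ∷ east (e ∸ b)) + f (S ∷ east (suc e))
      ≈⟨ +-comm _ _ ⟩
    f (S ∷ east (suc e)) + ∑[ b < suc e ] f (E ∷ east b ++ S ∷ east (e ∸ b))
      ≈⟨ sym (∑<-suc (suc e) _) ⟩
    ∑[ b < suc (suc e) ] f (east b ++ S ∷ east (suc e ∸ b)) ∎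

  ∑-words-2 : ∀ e (f : List Step → Carrier) →
              ∑∈ (words e 2) f ≈ ∑[ a < suc e ] ∑[ b < suc e ] (𝟙 (a ≤? b) * f (twoSouth e a b))
  ∑-words-2 zero f = begin
    f (S ∷ S ∷ []) + 0#
      ≈⟨ +-comm _ _ ⟩
    0# + f (S ∷ S ∷ [])
      ≈⟨ +-congˡ (sym (trans (+-identityˡ _) (trans (*-congʳ (𝟙-yes (0 ≤? 0) z≤n)) (*-identityˡ _)))) ⟩
    0# + (0# + 𝟙 (0 ≤? 0) * f (twoSouth 0 0 0)) ∎
  ∑-words-2 (suc e) f rewrite words-suc-suc e 1 = begin
    ∑∈ (map (E ∷_) (words e 2) ++ map (S ∷_) (words (suc e) 1)) f
      ≈⟨ ∑∈-++ (map (E ∷_) (words e 2)) _ f ⟩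
    ∑∈ (map (E ∷_) (words e 2)) f + ∑∈ (map (S ∷_) (words (suc e) 1)) f
      ≈⟨ +-comm _ _ ⟩
    ∑∈ (map (S ∷_) (words (suc e) 1)) f + ∑∈ (map (E ∷_) (words e 2)) f
      ≈⟨ +-cong (trans (∑∈-map (S ∷_) (words (suc e) 1) f) (∑-words-1 (suc e) (λ w → f (S ∷ w))))
                (trans (∑∈-map (E ∷_) (words e 2) f) (∑-words-2 e (λ w → f (E ∷ w)))) ⟩
    ∑[ b < suc (suc e) ] f (twoSouth (suc e) 0 b) + ∑[ a < suc e ] ∑[ b < suc e ] (𝟙 (a ≤? b) * f (twoSouth (suc e) (suc a) (suc b)))
      ≈⟨ +-cong (∑<-cong (suc (suc e)) (λ b _ → first-south-at-0 b)) (∑<-cong (suc e) (λ a _ → later-first-south a)) ⟩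
    ∑[ b < suc (suc e) ] (𝟙 (0 ≤? b) * f (twoSouth (suc e) 0 b))
      + ∑[ a < suc e ] ∑[ b < suc (suc e) ] (𝟙 (suc a ≤? b) * f (twoSouth (suc e) (suc a) b))
      ≈⟨ sym (∑<-suc (suc e) _) ⟩
    ∑[ a < suc (suc e) ] ∑[ b < suc (suc e) ] (𝟙 (a ≤? b) * f (twoSouth (suc e) a b)) ∎
    where
    first-south-at-0 : ∀ b → f (twoSouth (suc e) 0 b) ≈ 𝟙 (0 ≤? b) * f (twoSouth (suc e) 0 b)
    first-south-at-0 b = sym (trans (*-congʳ (𝟙-yes (0 ≤? b) z≤n)) (*-identityˡ _))
    later-first-south : ∀ a → ∑[ b < suc e ] (𝟙 (a ≤? b) * f (twoSouth (suc e) (suc a) (suc b)))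
                            ≈ ∑[ b < suc (suc e) ] (𝟙 (suc a ≤? b) * f (twoSouth (suc e) (suc a) b))
    later-first-south a = sym (begin
      ∑[ b < suc (suc e) ] (𝟙 (suc a ≤? b) * f (twoSouth (suc e) (suc a) b))
        ≈⟨ ∑<-suc (suc e) _ ⟩
      𝟙 (suc a ≤? 0) * f (twoSouth (suc e) (suc a) 0) + ∑[ b < suc e ] (𝟙 (suc a ≤? suc b) * f (twoSouth (suc e) (suc a) (suc b)))
        ≈⟨ +-cong (trans (*-congʳ (𝟙-no (suc a ≤? 0) λ ())) (zeroˡ _))
                  (∑<-cong (suc e) (λ b _ → *-congʳ (𝟙-⇔ (suc a ≤? suc b) (a ≤? b) ℕ.≤-pred s≤s))) ⟩
      0# + ∑[ b < suc e ] (𝟙 (a ≤? b) * f (twoSouth (suc e) (suc a) (suc b)))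
        ≈⟨ +-identityˡ _ ⟩
      ∑[ b < suc e ] (𝟙 (a ≤? b) * f (twoSouth (suc e) (suc a) (suc b))) ∎)

  ∑-paths-middle : ∀ n (f : Path → Carrier) →
                   ∑∈ (paths (A (2 ℕ.+ n)) (B (suc n))) f ≈ ∑[ a < suc n ] ∑[ b < suc n ] (𝟙 (a ≤? b) * f (middlePath n a b))
  ∑-paths-middle n f = begin
    ∑∈ (paths (A (2 ℕ.+ n)) (B (suc n))) f        ≡⟨ ≡.cong (λ ωs → ∑∈ ωs f) (paths-middle n) ⟩
    ∑∈ (map ((0 , 2 ℕ.* suc n) ,_) (words n 2)) f ≈⟨ ∑∈-map _ (words n 2) f ⟩
    ∑[ w ∈ words n 2 ] f ((0 , 2 ℕ.* suc n) , w)  ≈⟨ ∑-words-2 n _ ⟩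
    ∑[ a < suc n ] ∑[ b < suc n ] (𝟙 (a ≤? b) * f (middlePath n a b)) ∎

  middlePath-suc : ∀ n a b → middlePath (suc n) a b ≡ ((0 , 2 ℕ.+ 2 ℕ.* suc n) , twoSouth (suc n) a b)
  middlePath-suc n a b = ≡.cong (λ y → (0 , y) , twoSouth (suc n) a b) (ℕ.*-suc 2 (suc n))

  𝟙-middlePaths-disjoint : ∀ n a′ b′ a b → a ≤ b →
                           𝟙 (disjointPaths? (middlePath n a′ b′) (middlePath (suc n) a b)) ≈ 𝟙 (a′ <? b)
  𝟙-middlePaths-disjoint n a′ b′ a b a≤b =
    𝟙-⇔ (disjointPaths? (middlePath n a′ b′) (middlePath (suc n) a b)) (a′ <? b)
        (λ disjoint → twoSouth-disjoint⇒ y n a′ b′ (suc n) a b a≤b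
                        (≡.subst (DisjointPaths (middlePath n a′ b′)) (middlePath-suc n a b) disjoint))
        (λ a′<b → ≡.subst (DisjointPaths (middlePath n a′ b′)) (≡.sym (middlePath-suc n a b))
                          (twoSouth-disjoint⇐ y n a′ b′ (suc n) a b (s≤s z≤n) a≤b a′<b))
    where
    y : ℕ
    y = 2 ℕ.* suc n

  middlePath-above : ∀ n a b → a ≤ b → Above (2 ℕ.* suc n) (middlePath (suc n) a b)
  middlePath-above n a b a≤b = ≡.subst (Above (2 ℕ.* suc n)) (≡.sym (middlePath-suc n a b))
                                        (All.map proj₁ (twoSouth-upperSide (2 ℕ.* suc n) (suc n) a b a≤b))

  module Middle (l′ : ℕ) where

    l : ℕ
    l = suc l′

    open MiddleChains R q l

    middles : ℕ → List (Point × Point)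
    middles t = map middle (range l t)

    middles-suc : ∀ t → middles (suc t) ≡ middles t ++ middle (l ℕ.+ t) ∷ []
    middles-suc t = ≡.trans (≡.cong (map middle) (range-suc l t)) (map-++ middle (range l t) _)

    middles-below : ∀ t → All (λ e → row (proj₁ e) < 2 ℕ.* (l ℕ.+ t)) (middles t)
    middles-below t = All.map⁺ (All.map (λ {i} b → ≡.subst (_< 2 ℕ.* (l ℕ.+ t)) (≡.sym (2*suc∸2 i)) (ℕ.*-monoʳ-< 2 (proj₂ b)))
                                        (range-bounds l t))

    ∑-middlePaths : ∀ t (H W : Path → Carrier) (h : ℕ → Carrier) →
                    (∀ a b → a ≤ b → b < l ℕ.+ t → H (middlePath (l′ ℕ.+ t) a b) ≈ h a) →
                    (∀ a b → a ≤ b → W (middlePath (l′ ℕ.+ t) a b) ≈ chain t b) →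
                    ∑[ ω ∈ paths (A (suc (l ℕ.+ t))) (B (l ℕ.+ t)) ] (H ω * (q^ area ω * W ω))
                      ≈ ∑[ a < l ℕ.+ t ] (h a * (q^ a * link t a))
    ∑-middlePaths t H W h H≈h W≈chain = begin
      ∑[ ω ∈ paths (A (suc (l ℕ.+ t))) (B (l ℕ.+ t)) ] (H ω * (q^ area ω * W ω))
        ≈⟨ ∑-paths-middle m _ ⟩
      ∑[ a < l ℕ.+ t ] ∑[ b < l ℕ.+ t ] (𝟙 (a ≤? b) * (H (ω a b) * (q^ area (ω a b) * W (ω a b))))
        ≈⟨ ∑<-cong (l ℕ.+ t) (λ a _ → ∑<-cong (l ℕ.+ t) (λ b b< →
             𝟙-*-cong (a ≤? b) (λ a≤b → evaluate a b a≤b b<))) ⟩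
      ∑[ a < l ℕ.+ t ] ∑[ b < l ℕ.+ t ] (𝟙 (a ≤? b) * (h a * (q^ a * (q^ b * chain t b))))
        ≈⟨ ∑<-cong (l ℕ.+ t) (λ a _ → ∑<-cong (l ℕ.+ t) (λ b _ → rearrange _ _ _ _)) ⟩
      ∑[ a < l ℕ.+ t ] ∑[ b < l ℕ.+ t ] (h a * (q^ a * (𝟙 (a ≤? b) * (q^ b * chain t b))))
        ≈⟨ sym (∑<-cong (l ℕ.+ t) (λ a _ → trans (*-congˡ (*-distribˡ-∑< (l ℕ.+ t) _ _)) (*-distribˡ-∑< (l ℕ.+ t) _ _))) ⟩
      ∑[ a < l ℕ.+ t ] (h a * (q^ a * link t a)) ∎
      where
      open Ring-Solver
      m : ℕ
      m = l′ ℕ.+ t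
      ω : ℕ → ℕ → Path
      ω = middlePath m
      evaluate : ∀ a b → a ≤ b → b < l ℕ.+ t → H (ω a b) * (q^ area (ω a b) * W (ω a b)) ≈ h a * (q^ a * (q^ b * chain t b))
      evaluate a b a≤b b< = *-cong (H≈h a b a≤b b<)
        (trans (*-cong (trans (reflexive (≡.cong q^_ (area-twoSouth m a b a≤b))) (pow-+ q a b)) (W≈chain a b a≤b)) (*-assoc _ _ _))
      rearrange : ∀ i x y z → i * (x * (y * z)) ≈ x * (y * (i * z))
      rearrange = solve 4 (λ i x y z → i :* (x :* (y :* z)) := x :* (y :* (i :* z))) refl

    weightAvoiding-middles : ∀ t a b → a ≤ b → weightAvoiding (middles t) (middlePath (l′ ℕ.+ t) a b) ≈ chain t b
    weightAvoiding-middles zero a b a≤b =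
      trans (+-identityʳ _) (trans (*-cong (𝟙-yes (pairwiseDisjoint? []) [])
                                           (trans (*-congʳ (𝟙-yes (avoids? [] (middlePath l′ a b)) [])) (*-identityˡ 1#)))
                                   (*-identityˡ 1#))
    weightAvoiding-middles (suc t) a b a≤b = begin
      weightAvoiding (middles (suc t)) (middlePath (l′ ℕ.+ suc t) a b)
        ≡⟨ ≡.cong₂ weightAvoiding (middles-suc t) (≡.cong (λ n → middlePath n a b) (ℕ.+-suc l′ t)) ⟩
      weightAvoiding (middles t ++ middle (l ℕ.+ t) ∷ []) ω
        ≈⟨ weightAvoiding-snoc (middles t) _ _ ω avoided ⟩
      ∑[ ω′ ∈ paths (A (suc (l ℕ.+ t))) (B (l ℕ.+ t)) ] (𝟙 (disjointPaths? ω′ ω) * (q^ area ω′ * weightAvoiding (middles t) ω′))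
        ≈⟨ ∑-middlePaths t (λ ω′ → 𝟙 (disjointPaths? ω′ ω)) (weightAvoiding (middles t)) (λ a′ → 𝟙 (a′ <? b))
                         (λ a′ b′ _ _ → 𝟙-middlePaths-disjoint (l′ ℕ.+ t) a′ b′ a b a≤b) (weightAvoiding-middles t) ⟩
      chain (suc t) b ∎
      where
      ω : Path
      ω = middlePath (suc (l′ ℕ.+ t)) a b
      avoided : All (λ Ω → Avoids Ω ω) (families (middles t))
      avoided = All.map (All.map (λ {ω′} below → below-above-disjoint _ ω′ ω below (middlePath-above (l′ ℕ.+ t) a b a≤b)))
                        (families-below _ (middles t) (middles-below t))

    weight-middles : ∀ t → weight (middles t) ≈ middleSum t
    weight-middles zero    = weight-[]
    weight-middles (suc t) = begin
      weight (middles (suc t))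
        ≡⟨ ≡.cong weight (middles-suc t) ⟩
      weight (middles t ++ middle (l ℕ.+ t) ∷ [])
        ≈⟨ weight-snoc (middles t) _ _ ⟩
      ∑[ ω ∈ paths (A (suc (l ℕ.+ t))) (B (l ℕ.+ t)) ] (q^ area ω * weightAvoiding (middles t) ω)
        ≈⟨ sym (∑∈-cong (paths (A (suc (l ℕ.+ t))) (B (l ℕ.+ t))) (λ _ → *-identityˡ _)) ⟩
      ∑[ ω ∈ paths (A (suc (l ℕ.+ t))) (B (l ℕ.+ t)) ] (1# * (q^ area ω * weightAvoiding (middles t) ω))
        ≈⟨ ∑-middlePaths t (λ _ → 1#) (weightAvoiding (middles t)) (λ a → 𝟙 (a <? l ℕ.+ t))
                         (λ a b a≤b b< → sym (𝟙-yes (a <? l ℕ.+ t) (ℕ.≤-<-trans a≤b b<))) (weightAvoiding-middles t) ⟩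
      middleSum (suc t) ∎

    admissible-sum : ∀ n T → l ℕ.+ T ≤ n → sumList R (admissibleFamilies n (l ℕ.+ T) l) (ψ R q) ≈ middleSum T
    admissible-sum n T k≤n = begin
      sumList R (admissibleFamilies n k l) (ψ R q)
        ≈⟨ sumList≈∑∈ (admissibleFamilies n k l) (ψ R q) ⟩
      ∑∈ (filter pairwiseDisjoint? (families (endpoints n k l))) (ψ R q)
        ≈⟨ ∑∈-filter pairwiseDisjoint? (families (endpoints n k l)) (ψ R q) ⟩
      weight (endpoints n k l)
        ≡⟨ ≡.cong weight (endpoints-split n l′ T k≤n) ⟩
      weight (lower ++ (middles T ++ upper))
        ≈⟨ weight-++ (2 ℕ.* l ∸ 2) lower _ lower-below (All.++⁺ middles-above upper-above-l) ⟩
      weight lower * weight (middles T ++ upper)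
        ≈⟨ *-cong (weight-horizontals 1 l′ (s≤s z≤n))
                  (weight-++ (2 ℕ.* suc k ∸ 2) (middles T) upper middles-below′ upper-above-k) ⟩
      1# * (weight (middles T) * weight upper)
        ≈⟨ *-identityˡ _ ⟩
      weight (middles T) * weight upper
        ≈⟨ *-cong (weight-middles T) (weight-horizontals (suc k) (n ∸ k) (s≤s z≤n)) ⟩
      middleSum T * 1#
        ≈⟨ *-identityʳ _ ⟩
      middleSum T ∎
      where
      k : ℕ
      k = l ℕ.+ T
      lower upper : List (Point × Point)
      lower = map horizontal (range 1 l′)
      upper = map horizontal (range (suc k) (n ∸ k))
      lower-below : All (λ e → row (proj₁ e) < 2 ℕ.* l ∸ 2) lower
      lower-below = All.map⁺ (All.map (λ b → 2*∸2-mono-< (proj₁ b) (proj₂ b)) (range-bounds 1 l′))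
      middles-above : All (λ e → 2 ℕ.* l ∸ 2 ≤ row (proj₂ e)) (middles T)
      middles-above = All.map⁺ (All.map (λ b → 2*∸2-mono-≤ (proj₁ b)) (range-bounds l T))
      upper-above-l : All (λ e → 2 ℕ.* l ∸ 2 ≤ row (proj₂ e)) upper
      upper-above-l = All.map⁺ (All.map (λ b → 2*∸2-mono-≤ (ℕ.≤-trans (ℕ.m≤m+n l T) (ℕ.<⇒≤ (proj₁ b))))
                                        (range-bounds (suc k) (n ∸ k)))
      middles-below′ : All (λ e → row (proj₁ e) < 2 ℕ.* suc k ∸ 2) (middles T)
      middles-below′ = All.map⁺ (All.map (λ b → 2*∸2-mono-< (s≤s z≤n) (s≤s (proj₂ b))) (range-bounds l T))
      upper-above-k : All (λ e → 2 ℕ.* suc k ∸ 2 ≤ row (proj₂ e)) upper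
      upper-above-k = All.map⁺ (All.map (λ b → 2*∸2-mono-≤ (proj₁ b)) (range-bounds (suc k) (n ∸ k)))

theorem8 : ∀ {c ℓ : Level} (R : CommutativeRing c ℓ) (q : CommutativeRing.Carrier R)
             (M : ℕ → ℕ → CommutativeRing.Carrier R) →
             IsInverseOfH R q M →
             (n k l : ℕ) → 1 ≤ l → l ≤ k → k ≤ n →
             CommutativeRing._≈_ R (M k l)
               (CommutativeRing._*_ R
                 (pow R (CommutativeRing.-_ R (CommutativeRing.1# R)) (k ∸ l))
                 (sumList R (admissibleFamilies n k l) (ψ R q)))
theorem8 R q M inv n k l@(suc l′) (s≤s z≤n) l≤k k≤n = begin
  M k l                                                      ≈⟨ inverse-column M inv k l≤k ⟩
  sgn (k ∸ l) * middleSum (k ∸ l)                            ≈⟨ *-congˡ (sym admissible-sum′) ⟩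
  sgn (k ∸ l) * sumList R (admissibleFamilies n k l) (ψ R q) ∎
  where
  open CommutativeRing R
  open SetoidReasoning setoid
  open InverseColumn R q l′ using (inverse-column; sgn)
  open MiddleChains R q l using (middleSum)
  open FamilySums.Middle R q l′ using (admissible-sum)
  l+[k∸l]≡k : l ℕ.+ (k ∸ l) ≡ k
  l+[k∸l]≡k = ℕ.m+[n∸m]≡n l≤k
  admissible-sum′ : sumList R (admissibleFamilies n k l) (ψ R q) ≈ middleSum (k ∸ l)
  admissible-sum′ = ≡.subst (λ k′ → sumList R (admissibleFamilies n k′ l) (ψ R q) ≈ middleSum (k ∸ l)) l+[k∸l]≡k
                            (admissible-sum n (k ∸ l) (≡.subst (_≤ n) (≡.sym l+[k∸l]≡k) k≤n))
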